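{- The class $\mathrm{Ult}_{\mathrm{fin}}$ of all finite two-sorted ultrametric spaces with dc-embeddings is a Fraïssé class, and its Fraïssé limit $\mathbb{U}$ is dc-isomorphic to the countable rational Urysohn ultrametric space $\mathbb{U}_{\mathbb{Q}}$. In particular, $\mathbb{U}$ is both dc-homogeneous and iso-homogeneous.
   Context: A (two-sorted) ultrametric space is a triple $(X,d_X,D_X)$ where $D_X$ is a linearly ordered set with a least element $0$ (the distance set), $X$ is a set (of points) and $d_X\colon X\times X\to D_X$ is symmetric, satisfies $d_X(x,x')=0$ iff $x=x'$, and $d_X(x,x'')\le\max\{d_X(x,x'),d_X(x',x'')\}$. A dc-embedding $(X,d_X,D_X)\to(Y,d_Y,D_Y)$ is a pair consisting of an injective map $f\colon X\to Y$ and an order embedding $D_f\colon D_X\to D_Y$ with $D_f(0)=0$ such that $d_Y(f(x),f(x'))=D_f(d_X(x,x'))$ for all $x,x'\in X$; it is a dc-isomorphism if both maps are bijective, and an isometric embedding if $D_X\subseteq D_Y$ and $D_f$ is the inclusion. A substructure (subspace) of $X$ is $(A,d_X|_{A\times A},D_A)$ with $A\subseteq X$ and $d_X[A\times A]\subseteq D_A\subseteq D_X$ ($0\in D_A$). $\mathrm{Ult}_{\mathrm{fin}}$ is the class of ultrametric spaces with both $X$ and $D_X$ finite, with dc-embeddings. A class of finite structures with embeddings is a Fraïssé class if it is nonempty, has countably many isomorphism types, and has the joint embedding property and the amalgamation property (heredity is not required). Its Fraïssé limit is the (unique up to isomorphism) structure that is a union of a countable increasing chain of members of the class and is universal (every member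 embeds into it) and homogeneous (every isomorphism between finite substructures belonging to the class extends to an automorphism). An ultrametric space is dc-homogeneous if every dc-isomorphism between finite subspaces extends to a dc-automorphism, and iso-homogeneous if every isometry between finite subspaces (dc-isomorphism whose distance part is the identity) extends to a bijective isometry of the whole space. $\mathbb{U}_{\mathbb{Q}}$ is the classical countable rational Urysohn ultrametric space (the Fraïssé limit of finite ultrametric spaces with nonnegative rational distances and isometric embeddings), viewed as a two-sorted space with distance set $\mathbb{Q}^{\ge 0}$. -}

module Defs where

open import Data.Nat using (ℕ; suc)
open import Data.Fin using (Fin)
open import Data.Product using (Σ; ∃; ∃-syntax; _×_; _,_; proj₁; proj₂)
open import Data.Sum using (_⊎_; inj₁; inj₂)
open import Relation.Binary.PropositionalEquality
  using (_≡_; refl; cong; sym; trans; isEquivalence)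
open import Relation.Binary.Structures using (IsTotalOrder)
open import Function.Bundles using (_↔_)
open import Data.Rational using (ℚ; 0ℚ) renaming (_≤_ to _≤ℚ_)
import Data.Rational.Properties as ℚP

record Ult : Set₁ where
  field
    X   : Set
    D   : Set
    _≤_ : D → D → Set
    isTotalOrder : IsTotalOrder _≡_ _≤_
    0D  : D
    0-least : ∀ δ → 0D ≤ δ
    d   : X → X → D
    d-sym  : ∀ x y → d x y ≡ d y x
    d-zero : ∀ x y → (d x y ≡ 0D → x ≡ y) × (x ≡ y → d x y ≡ 0D)
    -- d(x,z) ≤ max{d(x,y), d(y,z)}, written out for a linear order
    d-ultra : ∀ x y z → (d x z ≤ d x y) ⊎ (d x z ≤ d y z)

open Ult

Surjective : {A B : Set} → (A → B) → Set
Surjective {A} {B} f = ∀ (b : B) → ∃[ a ] (f a ≡ b)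

Injective : {A B : Set} → (A → B) → Set
Injective {A} f = ∀ {a a' : A} → f a ≡ f a' → a ≡ a'

record _⇒_ (A B : Ult) : Set where
  field
    f   : X A → X B
    Df  : D A → D B
    f-inj    : Injective f
    Df-order : ∀ δ δ' → (_≤_ A δ δ' → _≤_ B (Df δ) (Df δ'))
                      × (_≤_ B (Df δ) (Df δ') → _≤_ A δ δ')
    Df-0     : Df (0D A) ≡ 0D B
    Df-inj   : Injective Df
    preserves : ∀ x x' → d B (f x) (f x') ≡ Df (d A x x')

open _⇒_

IsDcIso : {A B : Ult} → A ⇒ B → Set
IsDcIso e = Surjective (f e) × Surjective (Df e)

_≅_ : Ult → Ult → Set
A ≅ B = Σ (A ⇒ B) IsDcIso

_≗e_ : {A B : Ult} → A ⇒ B → A ⇒ B → Set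
e₁ ≗e e₂ = (∀ x → f e₁ x ≡ f e₂ x) × (∀ δ → Df e₁ δ ≡ Df e₂ δ)

_∘e_ : {A B C : Ult} → B ⇒ C → A ⇒ B → A ⇒ C
g ∘e h = record
  { f = λ x → f g (f h x)
  ; Df = λ δ → Df g (Df h δ)
  ; f-inj = λ p → f-inj h (f-inj g p)
  ; Df-order = λ δ δ' →
      (λ p → proj₁ (Df-order g _ _) (proj₁ (Df-order h δ δ') p))
    , (λ p → proj₂ (Df-order h δ δ') (proj₂ (Df-order g _ _) p))
  ; Df-0 = trans (cong (Df g) (Df-0 h)) (Df-0 g)
  ; Df-inj = λ p → Df-inj h (Df-inj g p)
  ; preserves = λ x x' → trans (preserves g _ _) (cong (Df g) (preserves h x x'))
  }

IsFiniteSet : Set → Set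
IsFiniteSet S = ∃[ n ] (S ↔ Fin n)

IsFinUlt : Ult → Set
IsFinUlt A = IsFiniteSet (X A) × IsFiniteSet (D A)

record IsFraisseClass (K : Ult → Set) : Set₁ where
  field
    nonempty : Σ Ult K
    countablyManyTypes :
      Σ (ℕ → Ult) λ S → ((∀ (n : ℕ) → K (S n)) × (∀ A → K A → ∃[ n ] (A ≅ S n)))
    jep : ∀ A B → K A → K B → Σ Ult λ C → (K C × (A ⇒ C) × (B ⇒ C))
    ap  : ∀ A B C → K A → K B → K C → (g : A ⇒ B) (h : A ⇒ C) →
          Σ Ult λ E → (K E × Σ (B ⇒ E) λ g' → Σ (C ⇒ E) λ h' → (g' ∘e g) ≗e (h' ∘e h))

-- dc-homogeneity, phrased via finite subspaces presented as images of
-- dc-embeddings of finite spaces: every dc-isomorphism between finite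
-- subspaces extends to a dc-automorphism.
DcHomogeneous : Ult → Set₁
DcHomogeneous U = ∀ (F : Ult) → IsFinUlt F → (e₁ e₂ : F ⇒ U) →
  Σ (U ≅ U) λ σ → (proj₁ σ ∘e e₁) ≗e e₂

-- iso-homogeneity: every isometry between finite subspaces (dc-isomorphism
-- whose distance part is the identity) extends to a bijective isometry.
IsoHomogeneous : Ult → Set₁
IsoHomogeneous U = ∀ (F : Ult) → IsFinUlt F → (e₁ e₂ : F ⇒ U) →
  (∀ δ → Df e₁ δ ≡ Df e₂ δ) →
  Σ (U ≅ U) λ σ → (∀ δ → Df (proj₁ σ) δ ≡ δ) × ((proj₁ σ ∘e e₁) ≗e e₂)

KHomogeneous : (Ult → Set) → Ult → Set₁
KHomogeneous K U = ∀ (F : Ult) → K F → (e₁ e₂ : F ⇒ U) →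
  Σ (U ≅ U) λ σ → (proj₁ σ ∘e e₁) ≗e e₂

record IsKChainUnion (K : Ult → Set) (U : Ult) : Set₁ where
  field
    C    : ℕ → Ult
    C∈K  : ∀ n → K (C n)
    ι    : ∀ n → C n ⇒ C (suc n)
    j    : ∀ n → C n ⇒ U
    j-compat : ∀ n → (j (suc n) ∘e ι n) ≗e j n
    cover-X  : ∀ (x : X U) → ∃[ n ] ∃[ y ] (f (j n) y ≡ x)
    cover-D  : ∀ (δ : D U) → ∃[ n ] ∃[ ε ] (Df (j n) ε ≡ δ)

record IsFraisseLimit (K : Ult → Set) (U : Ult) : Set₁ where
  field
    chain       : IsKChainUnion K U
    universal   : ∀ A → K A → A ⇒ U
    homogeneous : KHomogeneous K U

ℚ≥0 : Set
ℚ≥0 = Σ ℚ (λ q → 0ℚ ≤ℚ q)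

_≤₊_ : ℚ≥0 → ℚ≥0 → Set
p ≤₊ q = proj₁ p ≤ℚ proj₁ q

0₊ : ℚ≥0
0₊ = 0ℚ , ℚP.≤-refl

private
  ≡₊ : ∀ {p q : ℚ≥0} → proj₁ p ≡ proj₁ q → p ≡ q
  ≡₊ {p , a} {.p , b} refl = cong (p ,_) (ℚP.≤-irrelevant a b)

≤₊-isTotalOrder : IsTotalOrder _≡_ _≤₊_
≤₊-isTotalOrder = record
  { isPartialOrder = record
    { isPreorder = record
      { isEquivalence = isEquivalence
      ; reflexive = λ { refl → ℚP.≤-refl }
      ; trans = ℚP.≤-trans }
    ; antisym = λ p q → ≡₊ (ℚP.≤-antisym p q) }
  ; total = λ p q → ℚP.≤-total (proj₁ p) (proj₁ q) }

record RUlt : Set₁ where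
  field
    RX : Set
    rd : RX → RX → ℚ
    rd-nonneg : ∀ x y → 0ℚ ≤ℚ rd x y
    rd-sym  : ∀ x y → rd x y ≡ rd y x
    rd-zero : ∀ x y → (rd x y ≡ 0ℚ → x ≡ y) × (x ≡ y → rd x y ≡ 0ℚ)
    rd-ultra : ∀ x y z → (rd x z ≤ℚ rd x y) ⊎ (rd x z ≤ℚ rd y z)

open RUlt

asUlt : RUlt → Ult
asUlt V = record
  { X = RX V
  ; D = ℚ≥0
  ; _≤_ = _≤₊_
  ; isTotalOrder = ≤₊-isTotalOrder
  ; 0D = 0₊
  ; 0-least = λ δ → proj₂ δ
  ; d = λ x y → rd V x y , rd-nonneg V x y
  ; d-sym = λ x y → ≡₊ (rd-sym V x y)
  ; d-zero = λ x y → (λ p → proj₁ (rd-zero V x y) (cong proj₁ p))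
                   , (λ p → ≡₊ (proj₂ (rd-zero V x y) p))
  ; d-ultra = rd-ultra V
  }

record _⇒ᵢ_ (A B : RUlt) : Set where
  field
    g     : RX A → RX B
    g-inj : Injective g
    g-iso : ∀ x x' → rd B (g x) (g x') ≡ rd A x x'

open _⇒ᵢ_

IsFinRUlt : RUlt → Set
IsFinRUlt A = IsFiniteSet (RX A)

record IsRationalUrysohn (V : RUlt) : Set₁ where
  field
    C    : ℕ → RUlt
    C-fin : ∀ n → IsFinRUlt (C n)
    ι    : ∀ n → C n ⇒ᵢ C (suc n)
    j    : ∀ n → C n ⇒ᵢ V
    j-compat : ∀ n x → g (j (suc n)) (g (ι n) x) ≡ g (j n) x
    cover : ∀ (x : RX V) → ∃[ n ] ∃[ y ] (g (j n) y ≡ x)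
    universal : ∀ A → IsFinRUlt A → A ⇒ᵢ V
    homogeneous : ∀ (F : RUlt) → IsFinRUlt F → (e₁ e₂ : F ⇒ᵢ V) →
      Σ (V ⇒ᵢ V) λ σ → Surjective (g σ) × (∀ x → g σ (g e₁ x) ≡ g e₂ x)

-- Call an ultrametric space rich if its points and its distances can be enumerated, equality of
-- distances is decidable, and every finite partial dc-embedding into it (from a space with decidable
-- distances) extends to any one further point and to any one further distance.  A back-and-forth
-- argument, first on distances and then on points, shows that any two rich spaces are dc-isomorphic and
-- that a rich space is dc- and iso-homogeneous.  A rich space is also universal for Ult_fin and the union
-- of the chain of its subspaces spanned by the first n points and distances, so it is a Fraïssé limit;
-- embedding into it gives joint embedding and amalgamation, and as it has only countably many finite
-- subspaces, Ult_fin has countably many isomorphism types.  Every Fraïssé limit is rich (one-point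
-- extensions come from universality and homogeneity), every rational Urysohn space is rich (new
-- distances by density of ℚ, new points from its own universality and homogeneity), and a rich space
-- exists: finitely supported functions ℚ>0 → ℕ, at distance the largest argument where they differ.

module Submission where

open import Defs
open import Data.Empty using (⊥-elim)
open import Data.Nat as ℕ using (ℕ; zero; suc; _+_)
import Data.Nat.Properties as ℕ
open import Data.Integer using (ℤ; +_; -[1+_])
open import Data.Fin as Fin using (Fin; zero; suc; toℕ; fromℕ<)
import Data.Fin.Properties as Fin
import Data.Vec.Functional as Vector
open import Data.Maybe using (Maybe; just; nothing; _>>=_; zip; zipWith)
import Data.Maybe as Maybe
open import Data.List
  using (List; []; _∷_; _++_; map; length; lookup; allFin; deduplicate; cartesianProductWith; filter; fromMaybe)
open import Data.List.Membership.Propositional using (_∈_; _∉_)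
open import Data.List.Membership.Propositional.Properties
  using (∈-map⁺; ∈-map⁻; ∈-allFin; ∈-lookup; ∈-++⁺ˡ; ∈-++⁺ʳ; ∈-++⁻; ∈-deduplicate⁺; ∈-deduplicate⁻;
         ∈-cartesianProductWith⁺; ∈-cartesianProductWith⁻; ∈-filter⁺; ∈-filter⁻)
open import Data.List.Relation.Unary.All as All using (All; []; _∷_)
open import Data.List.Relation.Unary.AllPairs using (_∷_)
open import Data.List.Relation.Unary.Any as Any using (here; there; any?)
open import Data.List.Relation.Unary.Any.Properties using (lookup-index)
open import Data.List.Relation.Unary.Unique.Propositional using (Unique)
open import Data.List.Relation.Unary.Unique.DecPropositional.Properties using (deduplicate-!)
open import Data.Product using (Σ; ∃; ∃-syntax; ∃₂; _×_; _,_; proj₁; proj₂; swap; uncurry)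
open import Data.Sum using (_⊎_; inj₁; inj₂)
import Data.Sum as Sum
open import Data.Rational using (ℚ; 0ℚ; 1ℚ; _/_; _⊓_; _⊔_)
  renaming (_≤_ to _≤ℚ_; _<_ to _<ℚ_; _+_ to _+ℚ_)
import Data.Rational.Properties as ℚ
open import Relation.Nullary using (Dec; yes; no)
open import Relation.Nullary.Decidable using (map′; _×-dec_)
open import Relation.Binary.PropositionalEquality
open import Relation.Binary.Definitions using (DecidableEquality; tri<; tri≈; tri>)
open import Relation.Binary.Structures using (IsTotalOrder; IsStrictTotalOrder)
import Relation.Binary.Construct.NonStrictToStrict as NonStrictToStrict
open import Function.Bundles using (Inverse)
open import Function.Properties.Inverse using (↔⇒↣)
open import Function.Construct.Identity using (↔-id)

open Ult
open _⇒_
open RUlt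
open _⇒ᵢ_

record Enumeration (A : Set) : Set where
  field
    enum : ℕ → Maybe A
    enum-surjective : ∀ a → ∃[ n ] enum n ≡ just a

open Enumeration

diagonal-successor : ℕ × ℕ → ℕ × ℕ
diagonal-successor (a , zero) = 0 , suc a
diagonal-successor (a , suc b) = suc a , b

unpair : ℕ → ℕ × ℕ
unpair zero = 0 , 0
unpair (suc n) = diagonal-successor (unpair n)

unpair-surjective : ∀ a b → ∃[ n ] unpair n ≡ (a , b)
unpair-surjective a b = on-diagonal (a + b) a b refl
  where
  on-diagonal : ∀ s a b → a + b ≡ s → ∃[ n ] unpair n ≡ (a , b)
  on-diagonal _ zero zero _ = 0 , refl
  on-diagonal (suc s) zero (suc b) eq =
    let n , p = on-diagonal s b zero (trans (ℕ.+-identityʳ b) (ℕ.suc-injective eq))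
    in suc n , cong diagonal-successor p
  on-diagonal (suc s) (suc a) b eq =
    let n , p = on-diagonal (suc s) a (suc b) (trans (ℕ.+-suc a b) eq)
    in suc n , cong diagonal-successor p

ℕ²-enumeration : Enumeration (ℕ × ℕ)
ℕ²-enumeration = record
  { enum = λ n → just (unpair n)
  ; enum-surjective = λ (a , b) → let n , p = unpair-surjective a b in n , cong just p
  }

partialImage : {A B : Set} → Enumeration A → (g : A → Maybe B) → (∀ b → ∃[ a ] g a ≡ just b) →
               Enumeration B
partialImage e g g-surjective = record
  { enum = λ n → enum e n >>= g
  ; enum-surjective = λ b →
      let a , ga = g-surjective b
          n , ea = enum-surjective e a
      in n , trans (cong (_>>= g) ea) ga
  }

image : {A B : Set} → Enumeration A → (g : A → B) → Surjective g → Enumeration B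
image e g g-surjective =
  partialImage e (λ a → just (g a)) (λ b → let a , ga = g-surjective b in a , cong just ga)

_⊗_ : {A B : Set} → Enumeration A → Enumeration B → Enumeration (A × B)
_⊗_ {A} {B} eA eB = partialImage ℕ²-enumeration (λ (i , j) → zip (enum eA i) (enum eB j)) surjective
  where
  surjective : ∀ p → ∃[ ij ] zip (enum eA (proj₁ ij)) (enum eB (proj₂ ij)) ≡ just p
  surjective (a , b) =
    let i , ea = enum-surjective eA a
        j , eb = enum-surjective eB b
    in (i , j) , cong₂ zip ea eb

_⊕_ : {A B : Set} → Enumeration A → Enumeration B → Enumeration (A ⊎ B)
_⊕_ {A} {B} eA eB = partialImage ℕ²-enumeration select surjective
  where
  select : ℕ × ℕ → Maybe (A ⊎ B)
  select (zero , k) = Maybe.map inj₁ (enum eA k)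
  select (suc _ , k) = Maybe.map inj₂ (enum eB k)
  surjective : ∀ c → ∃[ ij ] select ij ≡ just c
  surjective (inj₁ a) = let k , ea = enum-surjective eA a in (0 , k) , cong (Maybe.map inj₁) ea
  surjective (inj₂ b) = let k , eb = enum-surjective eB b in (1 , k) , cong (Maybe.map inj₂) eb

module _ {A : Set} (e : Enumeration A) where

  listOfLength : ℕ → ℕ → Maybe (List A)
  listOfLength zero _ = just []
  listOfLength (suc k) n = zipWith _∷_ (enum e (proj₁ (unpair n))) (listOfLength k (proj₂ (unpair n)))

  listOfLength-surjective : ∀ xs → ∃[ n ] listOfLength (length xs) n ≡ just xs
  listOfLength-surjective [] = 0 , refl
  listOfLength-surjective (x ∷ xs) =
    let i , ex = enum-surjective e x
        j , exs = listOfLength-surjective xs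
        n , p = unpair-surjective i j
    in n , trans (cong (λ (i , j) → zipWith _∷_ (enum e i) (listOfLength (length xs) j)) p)
                 (cong₂ (zipWith _∷_) ex exs)

  lists : Enumeration (List A)
  lists = partialImage ℕ²-enumeration (uncurry listOfLength)
            (λ xs → let n , p = listOfLength-surjective xs in (length xs , n) , p)

ℕ-enumeration : Enumeration ℕ
ℕ-enumeration = record { enum = just ; enum-surjective = λ n → n , refl }

Fin-enumeration : ∀ n → Enumeration (Fin n)
Fin-enumeration n = record { enum = below ; enum-surjective = λ i → toℕ i , below-toℕ i }
  where
  below : ℕ → Maybe (Fin n)
  below k with k ℕ.<? n
  ... | yes k<n = just (fromℕ< k<n)
  ... | no _ = nothing
  below-toℕ : ∀ i → below (toℕ i) ≡ just i
  below-toℕ i with toℕ i ℕ.<? n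
  ... | yes i<n = cong just (Fin.fromℕ<-toℕ i i<n)
  ... | no i≮n = ⊥-elim (i≮n (Fin.toℕ<n i))

module _ {A : Set} (A-finite : IsFiniteSet A) where
  open Inverse (proj₂ A-finite)

  finite-enumeration : Enumeration A
  finite-enumeration = image (Fin-enumeration (proj₁ A-finite)) from (λ a → to a , strictlyInverseʳ a)

  elements : List A
  elements = map from (allFin (proj₁ A-finite))

  ∈-elements : ∀ a → a ∈ elements
  ∈-elements a = subst (_∈ elements) (strictlyInverseʳ a) (∈-map⁺ from (∈-allFin (to a)))

  finite-≟ : DecidableEquality A
  finite-≟ = Fin.inj⇒≟ (↔⇒↣ (proj₂ A-finite))

finite-Fin : ∀ n → IsFiniteSet (Fin n)
finite-Fin n = n , ↔-id (Fin n)

⋃-enumeration : {I : ℕ → Set} {B : Set} → (∀ n → Enumeration (I n)) → (g : ∀ n → I n → B) →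
                (∀ b → ∃[ n ] ∃[ a ] g n a ≡ b) → Enumeration B
⋃-enumeration {I} {B} es g covers = partialImage ℕ²-enumeration pick surjective
  where
  pick : ℕ × ℕ → Maybe B
  pick (n , i) = Maybe.map (g n) (enum (es n) i)
  surjective : ∀ b → ∃[ ni ] pick ni ≡ just b
  surjective b = let n , a , ga = covers b
                     i , ea = enum-surjective (es n) a
                 in (n , i) , trans (cong (Maybe.map (g n)) ea) (cong just ga)

module Order (U : Ult) where
  open IsTotalOrder (isTotalOrder U) public
    using ()
    renaming (refl to ≤-refl; reflexive to ≤-reflexive; antisym to ≤-antisym)

  ≤0⇒≡0 : ∀ {δ} → _≤_ U δ (0D U) → δ ≡ 0D U
  ≤0⇒≡0 δ≤0 = ≤-antisym δ≤0 (0-least U _)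

≟X-from-≟D : (U : Ult) → DecidableEquality (D U) → DecidableEquality (X U)
≟X-from-≟D U _≟_ x y = map′ (proj₁ (d-zero U x y)) (proj₂ (d-zero U x y)) (d U x y ≟ 0D U)

Coherent : {P : Set} → (P → P → Set) → List P → Set
Coherent R l = ∀ {p q} → p ∈ l → q ∈ l → R p q

module _ {P : Set} {R : P → P → Set} where

  coherent-⊆ : ∀ {l l′} → (∀ {p} → p ∈ l′ → p ∈ l) → Coherent R l → Coherent R l′
  coherent-⊆ l′⊆l c p∈ q∈ = c (l′⊆l p∈) (l′⊆l q∈)

  coherent-∷ : ∀ {l p} → Coherent R l → R p p → (∀ {q} → q ∈ l → R p q × R q p) →
               Coherent R (p ∷ l)
  coherent-∷ c pp pq (here refl) (here refl) = pp
  coherent-∷ c pp pq (here refl) (there q) = proj₁ (pq q)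
  coherent-∷ c pp pq (there p) (here refl) = proj₂ (pq p)
  coherent-∷ c pp pq (there p) (there q) = c p q

  coherent-∷-∈ : ∀ {l p} → p ∈ l → Coherent R l → Coherent R (p ∷ l)
  coherent-∷-∈ p∈ c = coherent-∷ c (c p∈ p∈) (λ q → c p∈ q , c q p∈)

  module _ {P′ : Set} {R′ : P′ → P′ → Set} {g : P → P′} where

    coherent-map⁺ : (∀ {p q} → R p q → R′ (g p) (g q)) → ∀ {l} → Coherent R l → Coherent R′ (map g l)
    coherent-map⁺ R⇒R′ c p∈ q∈ with ∈-map⁻ g p∈ | ∈-map⁻ g q∈
    ... | _ , p∈l , refl | _ , q∈l , refl = R⇒R′ (c p∈l q∈l)

    coherent-map⁻ : (∀ {p q} → R′ (g p) (g q) → R p q) → ∀ {l} → Coherent R′ (map g l) → Coherent R l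
    coherent-map⁻ R′⇒R c p∈ q∈ = R′⇒R (c (∈-map⁺ g p∈) (∈-map⁺ g q∈))

coherent-map : {A P : Set} {R : P → P → Set} (g : A → P) → (∀ a a' → R (g a) (g a')) →
               ∀ as → Coherent R (map g as)
coherent-map g R-image as p∈ q∈ with ∈-map⁻ g p∈ | ∈-map⁻ g q∈
... | a , _ , refl | a' , _ , refl = R-image a a'

partner : {A B : Set} {l : List (A × B)} {a : A} → a ∈ map proj₁ l → Σ B λ b → (a , b) ∈ l
partner a∈ with ∈-map⁻ proj₁ a∈
... | (_ , b) , ab∈ , refl = b , ab∈

module BackAndForth {A B : Set} (R : A × B → A × B → Set) where

  Forth : Set
  Forth = ∀ l → Coherent R l → (a : A) → Σ B λ b → Coherent R ((a , b) ∷ l)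

  Back : Set
  Back = ∀ l → Coherent R l → (b : B) → Σ A λ a → Coherent R ((a , b) ∷ l)

  Stage : Set
  Stage = Σ (List (A × B)) (Coherent R)

  -- Stage n + 1 answers the n-th request; any two reached pairs lie in a common stage.
  module Construction {Q : Set} (requests : Enumeration Q)
           (answer : Q → (l : List (A × B)) → Coherent R l → Σ (A × B) λ p → Coherent R (p ∷ l))
           (l₀ : List (A × B)) (c₀ : Coherent R l₀) where

    serve : Maybe Q → Stage → Stage
    serve nothing s = s
    serve (just q) (l , c) = proj₁ (answer q l c) ∷ l , proj₂ (answer q l c)

    stage : ℕ → Stage
    stage zero = l₀ , c₀
    stage (suc n) = serve (enum requests n) (stage n)

    _∈-stage_ : A × B → ℕ → Set
    p ∈-stage n = p ∈ proj₁ (stage n)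

    Reached : A × B → Set
    Reached p = ∃[ n ] p ∈-stage n

    serve-⊇ : ∀ r s {p} → p ∈ proj₁ s → p ∈ proj₁ (serve r s)
    serve-⊇ nothing s p∈ = p∈
    serve-⊇ (just q) s p∈ = there p∈

    stage-mono : ∀ k n {p} → p ∈-stage n → p ∈-stage (k + n)
    stage-mono zero n p∈ = p∈
    stage-mono (suc k) n p∈ = serve-⊇ (enum requests (k + n)) (stage (k + n)) (stage-mono k n p∈)

    reached-coherent : ∀ {p q} → Reached p → Reached q → R p q
    reached-coherent {p} {q} (n , p∈) (m , q∈) =
      proj₂ (stage (m + n)) (stage-mono m n p∈) (subst (q ∈-stage_) (ℕ.+-comm n m) (stage-mono n m q∈))

    reached-initial : ∀ {p} → p ∈ l₀ → Reached p
    reached-initial p∈ = 0 , p∈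

    answered : Q → A × B
    answered q = let n = proj₁ (enum-surjective requests q) in
                 proj₁ (answer q (proj₁ (stage n)) (proj₂ (stage n)))

    reached-answered : ∀ q → Reached (answered q)
    reached-answered q = suc n , served (enum requests n) (proj₂ (enum-surjective requests q))
      where
      n : ℕ
      n = proj₁ (enum-surjective requests q)
      served : ∀ r → r ≡ just q → answered q ∈ proj₁ (serve r (stage n))
      served .(just q) refl = here refl

  module ForthConstruction (as : Enumeration A) (forth : Forth) (l₀ : List (A × B)) (c₀ : Coherent R l₀) where
    open Construction as (λ a l c → (a , proj₁ (forth l c a)) , proj₂ (forth l c a)) l₀ c₀ public

    to : A → B
    to a = proj₂ (answered a)

    reached-to : ∀ a → Reached (a , to a)
    reached-to = reached-answered

  module BackAndForthConstruction (as : Enumeration A) (bs : Enumeration B)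
           (forth : Forth) (back : Back) (l₀ : List (A × B)) (c₀ : Coherent R l₀) where
    answer : A ⊎ B → (l : List (A × B)) → Coherent R l → Σ (A × B) λ p → Coherent R (p ∷ l)
    answer (inj₁ a) l c = (a , proj₁ (forth l c a)) , proj₂ (forth l c a)
    answer (inj₂ b) l c = (proj₁ (back l c b) , b) , proj₂ (back l c b)

    open Construction (as ⊕ bs) answer l₀ c₀ public

    to : A → B
    to a = proj₂ (answered (inj₁ a))

    from : B → A
    from b = proj₁ (answered (inj₂ b))

    reached-to : ∀ a → Reached (a , to a)
    reached-to a = reached-answered (inj₁ a)

    reached-from : ∀ b → Reached (from b , b)
    reached-from b = reached-answered (inj₂ b)

back-from-forth : {A B : Set} {R : A × B → A × B → Set} {R′ : B × A → B × A → Set} →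
                  (∀ {p q} → R p q → R′ (swap p) (swap q)) → (∀ {p q} → R′ (swap p) (swap q) → R p q) →
                  BackAndForth.Forth R′ → BackAndForth.Back R
back-from-forth R⇒R′ R′⇒R forth′ l c b =
  let a , c′ = forth′ (map swap l) (coherent-map⁺ R⇒R′ c) b
  in a , coherent-map⁻ R′⇒R {l = (a , b) ∷ l} c′

∘e-cancelˡ : {A B C : Ult} (m : B ⇒ C) {h h' : A ⇒ B} → (m ∘e h) ≗e (m ∘e h') → h ≗e h'
∘e-cancelˡ m (same-f , same-Df) = (λ x → f-inj m (same-f x)) , (λ δ → Df-inj m (same-Df δ))

lookup-injective : {A : Set} (xs : List A) → Unique xs → Injective (lookup xs)
lookup-injective (x ∷ xs) u {zero} {zero} eq = refl
lookup-injective (x ∷ xs) (x∉ ∷ u) {zero} {suc j} eq = ⊥-elim (All.lookup x∉ (∈-lookup j) eq)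
lookup-injective (x ∷ xs) (x∉ ∷ u) {suc i} {zero} eq = ⊥-elim (All.lookup x∉ (∈-lookup i) (sym eq))
lookup-injective (x ∷ xs) (x∉ ∷ u) {suc i} {suc j} eq = cong suc (lookup-injective xs u eq)

pullback-isTotalOrder : {A B : Set} {_≤_ : B → B → Set} → IsTotalOrder _≡_ _≤_ →
                        (g : A → B) → Injective g → IsTotalOrder _≡_ (λ a a' → g a ≤ g a')
pullback-isTotalOrder order g g-injective = record
  { isPartialOrder = record
    { isPreorder = record
      { isEquivalence = isEquivalence
      ; reflexive = λ { refl → O.refl }
      ; trans = O.trans }
    ; antisym = λ a≤b b≤a → g-injective (O.antisym a≤b b≤a) }
  ; total = λ a b → O.total (g a) (g b) }
  where module O = IsTotalOrder order

module Distinct {A : Set} (_≟_ : DecidableEquality A) (xs : List A) where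

  distinct : List A
  distinct = deduplicate _≟_ xs

  size : ℕ
  size = length distinct

  at : Fin size → A
  at = lookup distinct

  at-injective : Injective at
  at-injective = lookup-injective distinct (deduplicate-! _≟_ xs)

  at∈ : ∀ k → at k ∈ xs
  at∈ k = ∈-deduplicate⁻ _≟_ xs (∈-lookup k)

  locate : ∀ {x} → x ∈ xs → Fin size
  locate x∈ = Any.index (∈-deduplicate⁺ _≟_ x∈)

  at-locate : ∀ {x} (x∈ : x ∈ xs) → at (locate x∈) ≡ x
  at-locate x∈ = sym (lookup-index (∈-deduplicate⁺ _≟_ x∈))

module Span (U : Ult) (_≟_ : DecidableEquality (D U)) {n : ℕ}
            (p : Fin n → X U) (p-injective : Injective p) (ds₀ : List (D U)) where

  pairDistances : List (D U)
  pairDistances = cartesianProductWith (λ a b → d U (p a) (p b)) (allFin n) (allFin n)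

  candidates : List (D U)
  candidates = 0D U ∷ ds₀ ++ pairDistances

  open Distinct _≟_ candidates public
    renaming (size to m; at to δ-at; at-injective to δ-at-injective; at∈ to δ-at∈;
              locate to index-of; at-locate to δ-at-index)

  0∈ : 0D U ∈ candidates
  0∈ = here refl

  ds₀⊆ : ∀ {δ} → δ ∈ ds₀ → δ ∈ candidates
  ds₀⊆ δ∈ = there (∈-++⁺ˡ δ∈)

  pair∈ : ∀ a b → d U (p a) (p b) ∈ candidates
  pair∈ a b = there (∈-++⁺ʳ ds₀
                (∈-cartesianProductWith⁺ (λ a b → d U (p a) (p b)) (∈-allFin a) (∈-allFin b)))

  ∈-candidates⁻ : ∀ {δ} → δ ∈ candidates →
                  δ ≡ 0D U ⊎ δ ∈ ds₀ ⊎ ∃₂ λ a b → δ ≡ d U (p a) (p b)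
  ∈-candidates⁻ (here refl) = inj₁ refl
  ∈-candidates⁻ (there δ∈) with ∈-++⁻ ds₀ δ∈
  ... | inj₁ δ∈ds₀ = inj₂ (inj₁ δ∈ds₀)
  ... | inj₂ δ∈pairs with ∈-cartesianProductWith⁻ (λ a b → d U (p a) (p b)) (allFin n) (allFin n) δ∈pairs
  ...   | a , b , _ , _ , eq = inj₂ (inj₂ (a , b , eq))

  distance : Fin n → Fin n → Fin m
  distance a b = index-of (pair∈ a b)

  δ-at-distance : ∀ a b → δ-at (distance a b) ≡ d U (p a) (p b)
  δ-at-distance a b = δ-at-index (pair∈ a b)

  space : Ult
  space = record
    { X = Fin n
    ; D = Fin m
    ; _≤_ = λ i j → _≤_ U (δ-at i) (δ-at j)
    ; isTotalOrder = pullback-isTotalOrder (isTotalOrder U) δ-at δ-at-injective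
    ; 0D = index-of 0∈
    ; 0-least = λ i → subst (λ δ → _≤_ U δ (δ-at i)) (sym (δ-at-index 0∈)) (0-least U (δ-at i))
    ; d = distance
    ; d-sym = λ a b → δ-at-injective (begin
        δ-at (distance a b)  ≡⟨ δ-at-distance a b ⟩
        d U (p a) (p b)      ≡⟨ d-sym U _ _ ⟩
        d U (p b) (p a)      ≡⟨ δ-at-distance b a ⟨
        δ-at (distance b a)  ∎)
    ; d-zero = λ a b →
        (λ eq → p-injective (proj₁ (d-zero U _ _)
                  (trans (sym (δ-at-distance a b)) (trans (cong δ-at eq) (δ-at-index 0∈)))))
      , (λ eq → δ-at-injective (trans (δ-at-distance a b)
                  (trans (proj₂ (d-zero U _ _) (cong p eq)) (sym (δ-at-index 0∈)))))
    ; d-ultra = λ a b c → ultra (d-ultra U (p a) (p b) (p c))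
    }
    where
    open ≡-Reasoning
    ultra : ∀ {a b c} →
            _≤_ U (d U (p a) (p c)) (d U (p a) (p b)) ⊎ _≤_ U (d U (p a) (p c)) (d U (p b) (p c)) →
            _≤_ U (δ-at (distance a c)) (δ-at (distance a b)) ⊎
            _≤_ U (δ-at (distance a c)) (δ-at (distance b c))
    ultra {a} {b} {c} (inj₁ le) =
      inj₁ (subst₂ (_≤_ U) (sym (δ-at-distance a c)) (sym (δ-at-distance a b)) le)
    ultra {a} {b} {c} (inj₂ le) =
      inj₂ (subst₂ (_≤_ U) (sym (δ-at-distance a c)) (sym (δ-at-distance b c)) le)

  space-finite : IsFinUlt space
  space-finite = finite-Fin n , finite-Fin m

  inclusion : space ⇒ U
  inclusion = record
    { f = p
    ; Df = δ-at
    ; f-inj = p-injective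
    ; Df-order = λ _ _ → (λ le → le) , (λ le → le)
    ; Df-0 = δ-at-index 0∈
    ; Df-inj = δ-at-injective
    ; preserves = λ a b → sym (δ-at-distance a b)
    }

  corestrict : {F : Ult} (e : F ⇒ U) →
               (∀ x → Σ (Fin n) λ k → p k ≡ f e x) → (∀ δ → Df e δ ∈ candidates) →
               Σ (F ⇒ space) λ h → (inclusion ∘e h) ≗e e
  corestrict {F} e point∈ distance∈ = h , (λ x → proj₂ (point∈ x)) , (λ δ → δ-at-hD δ)
    where
    hf : X F → Fin n
    hf x = proj₁ (point∈ x)
    hD : D F → Fin m
    hD δ = index-of (distance∈ δ)
    δ-at-hD : ∀ δ → δ-at (hD δ) ≡ Df e δ
    δ-at-hD δ = δ-at-index (distance∈ δ)
    h : F ⇒ space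
    h = record
      { f = hf
      ; Df = hD
      ; f-inj = λ {x} {x'} eq →
          f-inj e (trans (sym (proj₂ (point∈ x))) (trans (cong p eq) (proj₂ (point∈ x'))))
      ; Df-order = λ δ δ' →
          (λ le → subst₂ (_≤_ U) (sym (δ-at-hD δ)) (sym (δ-at-hD δ')) (proj₁ (Df-order e δ δ') le))
        , (λ le → proj₂ (Df-order e δ δ') (subst₂ (_≤_ U) (δ-at-hD δ) (δ-at-hD δ') le))
      ; Df-0 = δ-at-injective (trans (δ-at-hD (0D F)) (trans (Df-0 e) (sym (δ-at-index 0∈))))
      ; Df-inj = λ {δ} {δ'} eq →
          Df-inj e (trans (sym (δ-at-hD δ)) (trans (cong δ-at eq) (δ-at-hD δ')))
      ; preserves = λ x x' → δ-at-injective (begin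
          δ-at (distance (hf x) (hf x'))  ≡⟨ δ-at-distance (hf x) (hf x') ⟩
          d U (p (hf x)) (p (hf x'))      ≡⟨ cong₂ (d U) (proj₂ (point∈ x)) (proj₂ (point∈ x')) ⟩
          d U (f e x) (f e x')            ≡⟨ preserves e x x' ⟩
          Df e (d F x x')                 ≡⟨ δ-at-hD (d F x x') ⟨
          δ-at (hD (d F x x'))            ∎)
      }
      where open ≡-Reasoning

module ListSpan (U : Ult) (_≟_ : DecidableEquality (D U)) (xs₀ : List (X U)) (ds₀ : List (D U)) where

  open Distinct (≟X-from-≟D U _≟_) xs₀ public
    using ()
    renaming (distinct to points; size to n; at to point-at; at-injective to point-at-injective;
              at∈ to point-at∈; locate to locate-point; at-locate to point-at-locate)

  open Span U _≟_ point-at point-at-injective ds₀ public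

  located : ∀ {x} → x ∈ xs₀ → Σ (Fin n) λ k → point-at k ≡ x
  located x∈ = locate-point x∈ , point-at-locate x∈

  point-pair∈ : ∀ {x x'} → x ∈ xs₀ → x' ∈ xs₀ → d U x x' ∈ candidates
  point-pair∈ x∈ x'∈ =
    subst₂ (λ x x' → d U x x' ∈ candidates) (point-at-locate x∈) (point-at-locate x'∈) (pair∈ _ _)

-- Distance embeddings and rich spaces

record IsDistanceEmbedding (S W : Ult) (φ : D S → D W) : Set where
  field
    mono : ∀ {δ δ'} → _≤_ S δ δ' → _≤_ W (φ δ) (φ δ')
    reflect : ∀ {δ δ'} → _≤_ W (φ δ) (φ δ') → _≤_ S δ δ'
    0↦0 : φ (0D S) ≡ 0D W

  injective : Injective φ
  injective eq = Order.≤-antisym S (reflect (Order.≤-reflexive W eq)) (reflect (Order.≤-reflexive W (sym eq)))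

  reflects-0 : ∀ {δ} → φ δ ≡ 0D W → δ ≡ 0D S
  reflects-0 eq = injective (trans eq (sym 0↦0))

Df-distanceEmbedding : {S W : Ult} (e : S ⇒ W) → IsDistanceEmbedding S W (Df e)
Df-distanceEmbedding e = record
  { mono = λ {δ} {δ'} → proj₁ (Df-order e δ δ')
  ; reflect = λ {δ} {δ'} → proj₂ (Df-order e δ δ')
  ; 0↦0 = Df-0 e
  }

∘-distanceEmbedding : {S T W : Ult} {φ : D T → D W} {χ : D S → D T} →
                      IsDistanceEmbedding T W φ → IsDistanceEmbedding S T χ →
                      IsDistanceEmbedding S W (λ δ → φ (χ δ))
∘-distanceEmbedding {φ = φ} φ-emb χ-emb = record
  { mono = λ le → φ.mono (χ.mono le)
  ; reflect = λ le → χ.reflect (φ.reflect le)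
  ; 0↦0 = trans (cong φ χ.0↦0) φ.0↦0
  }
  where
  module φ = IsDistanceEmbedding φ-emb
  module χ = IsDistanceEmbedding χ-emb

inverse-distanceEmbedding : {S W : Ult} {φ : D S → D W} {ψ : D W → D S} → IsDistanceEmbedding S W φ →
                            (∀ ε → φ (ψ ε) ≡ ε) → IsDistanceEmbedding W S ψ
inverse-distanceEmbedding {S} {W} {φ} {ψ} φ-emb φψ = record
  { mono = λ {ε} {ε'} le → reflect (subst₂ (_≤_ W) (sym (φψ ε)) (sym (φψ ε')) le)
  ; reflect = λ {ε} {ε'} le → subst₂ (_≤_ W) (φψ ε) (φψ ε') (mono le)
  ; 0↦0 = injective (trans (φψ (0D W)) (sym 0↦0))
  }
  where open IsDistanceEmbedding φ-emb

module _ {S W : Ult} {φ : D S → D W} (φ-emb : IsDistanceEmbedding S W φ) where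
  open IsDistanceEmbedding φ-emb

  isometry-embedding : (y : X S → X W) → (∀ x x' → d W (y x) (y x') ≡ φ (d S x x')) → S ⇒ W
  isometry-embedding y isometric = record
    { f = y
    ; Df = φ
    ; f-inj = λ {x} {x'} eq → proj₁ (d-zero S x x')
                (reflects-0 (trans (sym (isometric x x')) (proj₂ (d-zero W _ _) eq)))
    ; Df-order = λ _ _ → mono , reflect
    ; Df-0 = 0↦0
    ; Df-inj = injective
    ; preserves = isometric
    }

  isometric-diagonal : ∀ x y → d W y y ≡ φ (d S x x)
  isometric-diagonal x y =
    trans (proj₂ (d-zero W y y) refl) (trans (sym 0↦0) (cong φ (sym (proj₂ (d-zero S x x) refl))))

  partner-unique : ∀ {x y y'} → d W y y' ≡ φ (d S x x) → y ≡ y'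
  partner-unique eq = proj₁ (d-zero W _ _) (trans eq (trans (cong φ (proj₂ (d-zero S _ _) refl)) 0↦0))

module Matching (S W : Ult) where

  OrderMatched : D S × D W → D S × D W → Set
  OrderMatched (δ , ε) (δ' , ε') = (_≤_ S δ δ' → _≤_ W ε ε') × (_≤_ W ε ε' → _≤_ S δ δ')

  -- The second component lets coherent lists respect 0 without containing (0 , 0).
  Matched : D S × D W → D S × D W → Set
  Matched p q = OrderMatched p q × OrderMatched p (0D S , 0D W)

  IsometricUnder : (D S → D W) → X S × X W → X S × X W → Set
  IsometricUnder φ (x , y) (x' , y') = d W y y' ≡ φ (d S x x')

  matched⇒orderMatched : ∀ {l} → Coherent Matched l → Coherent OrderMatched ((0D S , 0D W) ∷ l)
  matched⇒orderMatched c =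
    coherent-∷ (λ p q → proj₁ (c p q)) ((λ _ → Order.≤-refl W) , (λ _ → Order.≤-refl S))
      λ q → ((λ _ → 0-least W _) , (λ _ → 0-least S _)) , proj₂ (c q q)

  orderMatched⇒matched : ∀ {l} → (0D S , 0D W) ∈ l → Coherent OrderMatched l → Coherent Matched l
  orderMatched⇒matched 0∈ c p q = c p q , c p 0∈

  order-functional : ∀ {δ ε ε'} → OrderMatched (δ , ε) (δ , ε') → OrderMatched (δ , ε') (δ , ε) →
                     ε ≡ ε'
  order-functional (to , _) (to' , _) = Order.≤-antisym W (to (Order.≤-refl S)) (to' (Order.≤-refl S))

module _ {S W : Ult} where
  open Matching

  swap-orderMatched : ∀ {p q} → OrderMatched S W p q → OrderMatched W S (swap p) (swap q)
  swap-orderMatched (to , from) = from , to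

  swap-matched : ∀ {p q} → Matched S W p q → Matched W S (swap p) (swap q)
  swap-matched (pq , p0) = swap-orderMatched pq , swap-orderMatched p0

DistanceExtension : Ult → Set₁
DistanceExtension W =
  ∀ (S : Ult) → DecidableEquality (D S) → ∀ l → Coherent (Matching.OrderMatched S W) l →
  (0D S , 0D W) ∈ l → ∀ δ → δ ∉ map proj₁ l →
  Σ (D W) λ ε → Coherent (Matching.OrderMatched S W) ((δ , ε) ∷ l)

PointRealization : Ult → Set₁
PointRealization W =
  ∀ (S : Ult) → DecidableEquality (D S) → (φ : D S → D W) → IsDistanceEmbedding S W φ →
  ∀ {n} (p : Fin (suc n) → X S) → Injective p → (y : Fin n → X W) →
  (∀ a b → d W (y a) (y b) ≡ φ (d S (p (suc a)) (p (suc b)))) →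
  Σ (X W) λ y₀ → ∀ a → d W y₀ (y a) ≡ φ (d S (p zero) (p (suc a)))

record ExtensionProperty (W : Ult) : Set₁ where
  field
    realize-point : PointRealization W
    extend-distance : DistanceExtension W

record Rich (W : Ult) : Set₁ where
  field
    _≟D_ : DecidableEquality (D W)
    points : Enumeration (X W)
    distances : Enumeration (D W)
    extension : ExtensionProperty W

∷-injective : {A : Set} {n : ℕ} {x : A} {g : Fin n → A} → Injective g → (∀ k → g k ≢ x) →
              Injective (x Vector.∷ g)
∷-injective g-inj fresh {zero} {zero} eq = refl
∷-injective g-inj fresh {zero} {suc k} eq = ⊥-elim (fresh k (sym eq))
∷-injective g-inj fresh {suc k} {zero} eq = ⊥-elim (fresh k eq)
∷-injective g-inj fresh {suc k} {suc k'} eq = cong suc (g-inj eq)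

module _ {S W : Ult} (_≟S_ : DecidableEquality (D S)) where
  open Matching S W

  distance-forth : DistanceExtension W → BackAndForth.Forth Matched
  distance-forth extend l c δ =
    let ε , c′ = extend⁺ ((0D S , 0D W) ∷ l) (matched⇒orderMatched c) (here refl)
    in ε , coherent-⊆ drop-0 (orderMatched⇒matched (there (here refl)) c′)
    where
    extend⁺ : ∀ l → Coherent OrderMatched l → (0D S , 0D W) ∈ l →
              Σ (D W) λ ε → Coherent OrderMatched ((δ , ε) ∷ l)
    extend⁺ l c 0∈ with any? (δ ≟S_) (map proj₁ l)
    ... | yes δ∈ = let ε , δε∈ = partner δ∈ in ε , coherent-∷-∈ δε∈ c
    ... | no δ∉ = extend S _≟S_ l c 0∈ δ δ∉
    drop-0 : ∀ {p q} → p ∈ q ∷ l → p ∈ q ∷ (0D S , 0D W) ∷ l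
    drop-0 (here eq) = here eq
    drop-0 (there p∈) = there (there p∈)

  module FreshPoint (realize : PointRealization W) {φ : D S → D W} (φ-emb : IsDistanceEmbedding S W φ)
                    (l : List (X S × X W)) (c : Coherent (IsometricUnder φ) l)
                    (x : X S) (x∉ : x ∉ map proj₁ l) where
    open Distinct (≟X-from-≟D S _≟S_) (map proj₁ l)

    y : Fin size → X W
    y k = proj₁ (partner (at∈ k))

    y∈ : ∀ k → (at k , y k) ∈ l
    y∈ k = proj₂ (partner (at∈ k))

    realized : Σ (X W) λ y₀ → ∀ k → d W y₀ (y k) ≡ φ (d S x (at k))
    realized = realize S _≟S_ φ φ-emb (x Vector.∷ at)
                 (∷-injective at-injective (λ k eq → x∉ (subst (_∈ map proj₁ l) eq (at∈ k))))
                 y (λ a b → c (y∈ a) (y∈ b))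

    y₀ : X W
    y₀ = proj₁ realized

    isometric-to : ∀ {x' y'} → (x' , y') ∈ l → IsometricUnder φ (x , y₀) (x' , y')
    isometric-to {x'} {y'} xy∈ = begin
      d W y₀ y'                 ≡⟨ cong (d W y₀) (partner-unique φ-emb (c (y∈ k) xy∈′)) ⟨
      d W y₀ (y k)              ≡⟨ proj₂ realized k ⟩
      φ (d S x (at k))          ≡⟨ cong (λ x' → φ (d S x x')) (at-locate x'∈) ⟩
      φ (d S x x')              ∎
      where
      open ≡-Reasoning
      x'∈ : x' ∈ map proj₁ l
      x'∈ = ∈-map⁺ proj₁ xy∈
      k : Fin size
      k = locate x'∈
      xy∈′ : (at k , y') ∈ l
      xy∈′ = subst (λ x' → (x' , y') ∈ l) (sym (at-locate x'∈)) xy∈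

    coherent : Coherent (IsometricUnder φ) ((x , y₀) ∷ l)
    coherent = coherent-∷ c (isometric-diagonal φ-emb x y₀)
      λ {(x' , y')} xy∈ → isometric-to xy∈
                        , trans (d-sym W _ _) (trans (isometric-to xy∈) (cong φ (d-sym S _ _)))

  point-forth : PointRealization W → ∀ {φ} → IsDistanceEmbedding S W φ →
                BackAndForth.Forth (IsometricUnder φ)
  point-forth realize φ-emb l c x with any? (≟X-from-≟D S _≟S_ x) (map proj₁ l)
  ... | yes x∈ = let y , xy∈ = partner x∈ in y , coherent-∷-∈ xy∈ c
  ... | no x∉ = FreshPoint.y₀ realize φ-emb l c x x∉ , FreshPoint.coherent realize φ-emb l c x x∉

open Matching

-- Back and forth between rich spaces

module MatchedGraph (S W : Ult) (Reached : D S × D W → Set)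
                    (coherent : ∀ {p q} → Reached p → Reached q → Matched S W p q)
                    (φ : D S → D W) (reached-φ : ∀ δ → Reached (δ , φ δ)) where

  φ-embedding : IsDistanceEmbedding S W φ
  φ-embedding = record
    { mono = λ {δ} {δ'} → proj₁ (proj₁ (coherent (reached-φ δ) (reached-φ δ')))
    ; reflect = λ {δ} {δ'} → proj₂ (proj₁ (coherent (reached-φ δ) (reached-φ δ')))
    ; 0↦0 = Order.≤0⇒≡0 W (proj₁ (proj₂ (coherent (reached-φ (0D S)) (reached-φ (0D S)))) (Order.≤-refl S))
    }

  φ-agrees : ∀ {δ ε} → Reached (δ , ε) → φ δ ≡ ε
  φ-agrees r = order-functional S W (proj₁ (coherent (reached-φ _) r)) (proj₁ (coherent r (reached-φ _)))

module IsometricGraph (S W : Ult) {φ : D S → D W} (φ-emb : IsDistanceEmbedding S W φ)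
                      (Reached : X S × X W → Set)
                      (coherent : ∀ {p q} → Reached p → Reached q → IsometricUnder S W φ p q)
                      (y : X S → X W) (reached-y : ∀ x → Reached (x , y x)) where

  embedding : S ⇒ W
  embedding = isometry-embedding φ-emb y (λ x x' → coherent (reached-y x) (reached-y x'))

  y-agrees : ∀ {x y'} → Reached (x , y') → y x ≡ y'
  y-agrees r = partner-unique φ-emb (coherent (reached-y _) r)

module DistanceForth {S W : Ult} (_≟S_ : DecidableEquality (D S)) (extend : DistanceExtension W)
                     (δs : Enumeration (D S))
                     (l₀ : List (D S × D W)) (c₀ : Coherent (Matched S W) l₀) where
  open BackAndForth.ForthConstruction (Matched S W) δs (distance-forth {S} {W} _≟S_ extend) l₀ c₀

  φ : D S → D W
  φ = to

  open MatchedGraph S W Reached reached-coherent φ reached-to public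

  φ-initial : ∀ {δ ε} → (δ , ε) ∈ l₀ → φ δ ≡ ε
  φ-initial δε∈ = φ-agrees (reached-initial δε∈)

module PointForth {S W : Ult} (_≟S_ : DecidableEquality (D S)) (realize : PointRealization W)
                  (xs : Enumeration (X S)) {φ : D S → D W} (φ-emb : IsDistanceEmbedding S W φ)
                  (l₀ : List (X S × X W)) (c₀ : Coherent (IsometricUnder S W φ) l₀) where
  open BackAndForth.ForthConstruction (IsometricUnder S W φ) xs (point-forth _≟S_ realize φ-emb) l₀ c₀
  open IsometricGraph S W φ-emb Reached reached-coherent to reached-to public

  embedding-initial : ∀ {x y} → (x , y) ∈ l₀ → f embedding x ≡ y
  embedding-initial xy∈ = y-agrees (reached-initial xy∈)

module DistanceBackAndForth {S W : Ult} (_≟S_ : DecidableEquality (D S)) (_≟W_ : DecidableEquality (D W))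
                            (extendS : DistanceExtension S) (extendW : DistanceExtension W)
                            (δs : Enumeration (D S)) (εs : Enumeration (D W))
                            (l₀ : List (D S × D W)) (c₀ : Coherent (Matched S W) l₀) where
  open BackAndForth.BackAndForthConstruction (Matched S W) δs εs (distance-forth {S} {W} _≟S_ extendW)
         (back-from-forth (swap-matched {S} {W}) (swap-matched {W} {S}) (distance-forth {W} {S} _≟W_ extendS)) l₀ c₀

  φ : D S → D W
  φ = to

  ψ : D W → D S
  ψ = from

  open MatchedGraph S W Reached reached-coherent φ reached-to public

  φ-initial : ∀ {δ ε} → (δ , ε) ∈ l₀ → φ δ ≡ ε
  φ-initial δε∈ = φ-agrees (reached-initial δε∈)

  φψ : ∀ ε → φ (ψ ε) ≡ ε
  φψ ε = φ-agrees (reached-from ε)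

module PointBackAndForth {S W : Ult} (_≟S_ : DecidableEquality (D S)) (_≟W_ : DecidableEquality (D W))
                         (realizeS : PointRealization S) (realizeW : PointRealization W)
                         (xs : Enumeration (X S)) (ys : Enumeration (X W))
                         {φ : D S → D W} {ψ : D W → D S} (φ-emb : IsDistanceEmbedding S W φ)
                         (φψ : ∀ ε → φ (ψ ε) ≡ ε)
                         (l₀ : List (X S × X W)) (c₀ : Coherent (IsometricUnder S W φ) l₀) where
  ψφ : ∀ δ → ψ (φ δ) ≡ δ
  ψφ δ = IsDistanceEmbedding.injective φ-emb (φψ (φ δ))

  to-ψ : ∀ {p q} → IsometricUnder S W φ p q → IsometricUnder W S ψ (swap p) (swap q)
  to-ψ eq = trans (sym (ψφ _)) (cong ψ (sym eq))

  from-ψ : ∀ {p q} → IsometricUnder W S ψ (swap p) (swap q) → IsometricUnder S W φ p q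
  from-ψ eq = trans (sym (φψ _)) (cong φ (sym eq))

  open BackAndForth.BackAndForthConstruction (IsometricUnder S W φ) xs ys
         (point-forth _≟S_ realizeW φ-emb)
         (back-from-forth to-ψ from-ψ (point-forth _≟W_ realizeS (inverse-distanceEmbedding φ-emb φψ)))
         l₀ c₀
  open IsometricGraph S W φ-emb Reached reached-coherent to reached-to public

  embedding-initial : ∀ {x y} → (x , y) ∈ l₀ → f embedding x ≡ y
  embedding-initial xy∈ = y-agrees (reached-initial xy∈)

  isomorphism : S ≅ W
  isomorphism = embedding , (λ y → from y , y-agrees (reached-from y)) , (λ ε → ψ ε , φψ ε)

module Images {F S W : Ult} (F-finite : IsFinUlt F) (e₁ : F ⇒ S) (e₂ : F ⇒ W) where
  open Σ F-finite renaming (proj₁ to finX; proj₂ to finD)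

  distance-pairs : List (D S × D W)
  distance-pairs = map (λ δ → Df e₁ δ , Df e₂ δ) (elements finD)

  ∈-distance-pairs : ∀ δ → (Df e₁ δ , Df e₂ δ) ∈ distance-pairs
  ∈-distance-pairs δ = ∈-map⁺ _ (∈-elements finD δ)

  distance-pairs-matched : Coherent (Matched S W) distance-pairs
  distance-pairs-matched = coherent-map {R = Matched S W} _ (λ δ δ' → order δ δ' , order-0 δ) (elements finD)
    where
    order : ∀ δ δ' → OrderMatched S W (Df e₁ δ , Df e₂ δ) (Df e₁ δ' , Df e₂ δ')
    order δ δ' = (λ le → proj₁ (Df-order e₂ δ δ') (proj₂ (Df-order e₁ δ δ') le))
               , (λ le → proj₁ (Df-order e₁ δ δ') (proj₂ (Df-order e₂ δ δ') le))
    order-0 : ∀ δ → OrderMatched S W (Df e₁ δ , Df e₂ δ) (0D S , 0D W)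
    order-0 δ = subst₂ (λ ε₁ ε₂ → OrderMatched S W (Df e₁ δ , Df e₂ δ) (ε₁ , ε₂))
                       (Df-0 e₁) (Df-0 e₂)
                  (order δ (0D F))

  point-pairs : List (X S × X W)
  point-pairs = map (λ x → f e₁ x , f e₂ x) (elements finX)

  ∈-point-pairs : ∀ x → (f e₁ x , f e₂ x) ∈ point-pairs
  ∈-point-pairs x = ∈-map⁺ _ (∈-elements finX x)

  point-pairs-isometric : ∀ {φ} → (∀ δ → φ (Df e₁ δ) ≡ Df e₂ δ) →
                          Coherent (IsometricUnder S W φ) point-pairs
  point-pairs-isometric {φ} φe₁≡e₂ = coherent-map {R = IsometricUnder S W φ} _ isometric (elements finX)
    where
    isometric : ∀ x x' → d W (f e₂ x) (f e₂ x') ≡ φ (d S (f e₁ x) (f e₁ x'))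
    isometric x x' = begin
      d W (f e₂ x) (f e₂ x')      ≡⟨ preserves e₂ x x' ⟩
      Df e₂ (d F x x')            ≡⟨ φe₁≡e₂ (d F x x') ⟨
      φ (Df e₁ (d F x x'))        ≡⟨ cong φ (preserves e₁ x x') ⟨
      φ (d S (f e₁ x) (f e₁ x'))  ∎
      where open ≡-Reasoning

FiniteExtension : Ult → Set₁
FiniteExtension W = ∀ F G → IsFinUlt F → IsFinUlt G → (i : F ⇒ G) (e : F ⇒ W) →
                    Σ (G ⇒ W) λ e' → (e' ∘e i) ≗e e

module _ {W : Ult} (extension : ExtensionProperty W) where
  open ExtensionProperty extension

  extension-universal : ∀ A → IsFinUlt A → A ⇒ W
  extension-universal A (finX , finD) = P.embedding
    where
    module Δ = DistanceForth {A} (finite-≟ finD) extend-distance (finite-enumeration finD) [] (λ ())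
    module P = PointForth {A} (finite-≟ finD) realize-point (finite-enumeration finX) Δ.φ-embedding [] (λ ())

  extension-finiteExtension : FiniteExtension W
  extension-finiteExtension F G finF (finX , finD) i e =
    P.embedding , (λ x → P.embedding-initial (∈-point-pairs x)) , (λ δ → Δ.φ-initial (∈-distance-pairs δ))
    where
    open Images finF i e
    module Δ = DistanceForth {G} (finite-≟ finD) extend-distance (finite-enumeration finD)
                 distance-pairs distance-pairs-matched
    module P = PointForth {G} (finite-≟ finD) realize-point (finite-enumeration finX) Δ.φ-embedding
                 point-pairs (point-pairs-isometric {Δ.φ} (λ δ → Δ.φ-initial (∈-distance-pairs δ)))

module _ {W : Ult} (rich : Rich W) where
  open Rich rich
  open ExtensionProperty extension

  rich-homogeneous : KHomogeneous IsFinUlt W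
  rich-homogeneous F finF e₁ e₂ =
    P.isomorphism , (λ x → P.embedding-initial (∈-point-pairs x)) , (λ δ → Δ.φ-initial (∈-distance-pairs δ))
    where
    open Images finF e₁ e₂
    module Δ = DistanceBackAndForth {W} _≟D_ _≟D_ extend-distance extend-distance distances distances
                 distance-pairs distance-pairs-matched
    module P = PointBackAndForth {W} _≟D_ _≟D_ realize-point realize-point points points Δ.φ-embedding Δ.φψ
                 point-pairs (point-pairs-isometric {Δ.φ} (λ δ → Δ.φ-initial (∈-distance-pairs δ)))

  rich-isoHomogeneous : IsoHomogeneous W
  rich-isoHomogeneous F finF e₁ e₂ e₁≡e₂ =
    P.isomorphism , (λ _ → refl) , (λ x → P.embedding-initial (∈-point-pairs x)) , e₁≡e₂
    where
    open Images finF e₁ e₂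
    identity : IsDistanceEmbedding W W (λ δ → δ)
    identity = record { mono = λ le → le ; reflect = λ le → le ; 0↦0 = refl }
    module P = PointBackAndForth {W} _≟D_ _≟D_ realize-point realize-point points points identity (λ _ → refl)
                 point-pairs (point-pairs-isometric {λ δ → δ} e₁≡e₂)

rich-≅ : {S W : Ult} → Rich S → Rich W → S ≅ W
rich-≅ {S} {W} richS richW = P.isomorphism
  where
  module S = Rich richS
  module W = Rich richW
  module Δ = DistanceBackAndForth {S} {W} S._≟D_ W._≟D_
               (ExtensionProperty.extend-distance S.extension) (ExtensionProperty.extend-distance W.extension)
               S.distances W.distances [] (λ ())
  module P = PointBackAndForth {S} {W} S._≟D_ W._≟D_
               (ExtensionProperty.realize-point S.extension) (ExtensionProperty.realize-point W.extension)
               S.points W.points Δ.φ-embedding Δ.φψ [] (λ ())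

-- Rich spaces are Fraïssé limits of Ult_fin

module _ {A : Set} (e : Enumeration A) where

  prefix : ℕ → List A
  prefix zero = []
  prefix (suc n) = fromMaybe (enum e n) ++ prefix n

  prefix-mono : ∀ {a} n → a ∈ prefix n → a ∈ prefix (suc n)
  prefix-mono n = ∈-++⁺ʳ (fromMaybe (enum e n))

  prefix-hit : ∀ {a} n → enum e n ≡ just a → a ∈ prefix (suc n)
  prefix-hit n eq = ∈-++⁺ˡ (subst (λ m → _ ∈ fromMaybe m) (sym eq) (here refl))

module _ {B W : Ult} (B-finite : IsFinUlt B) (e : B ⇒ W) where
  open Σ B-finite renaming (proj₁ to finX; proj₂ to finD)

  imagePoints : List (X W)
  imagePoints = map (f e) (elements finX)

  ∈-imagePoints : ∀ x → f e x ∈ imagePoints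
  ∈-imagePoints x = ∈-map⁺ (f e) (∈-elements finX x)

  imageDistances : List (D W)
  imageDistances = map (Df e) (elements finD)

  ∈-imageDistances : ∀ δ → Df e δ ∈ imageDistances
  ∈-imageDistances δ = ∈-map⁺ (Df e) (∈-elements finD δ)

module _ {W : Ult} (rich : Rich W) where
  open Rich rich

  rich-universal : ∀ B → IsFinUlt B → B ⇒ W
  rich-universal = extension-universal extension

  module PrefixSpan (n : ℕ) = ListSpan W _≟D_ (prefix points n) (prefix distances n)

  stage-step : ∀ n → Σ (PrefixSpan.space n ⇒ PrefixSpan.space (suc n)) λ ι →
                 (PrefixSpan.inclusion (suc n) ∘e ι) ≗e PrefixSpan.inclusion n
  stage-step n = Next.corestrict (Now.inclusion) (λ k → Next.located (prefix-mono points n (Now.point-at∈ k)))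
                   distance∈
    where
    module Now = PrefixSpan n
    module Next = PrefixSpan (suc n)
    distance∈ : ∀ k → Now.δ-at k ∈ Next.candidates
    distance∈ k with Now.∈-candidates⁻ (Now.δ-at∈ k)
    ... | inj₁ eq = subst (_∈ Next.candidates) (sym eq) Next.0∈
    ... | inj₂ (inj₁ δ∈) = Next.ds₀⊆ (prefix-mono distances n δ∈)
    ... | inj₂ (inj₂ (a , b , eq)) =
      subst (_∈ Next.candidates) (sym eq)
        (Next.point-pair∈ (prefix-mono points n (Now.point-at∈ a)) (prefix-mono points n (Now.point-at∈ b)))

  rich-fraisseLimit : IsFraisseLimit IsFinUlt W
  rich-fraisseLimit = record
    { chain = record
      { C = PrefixSpan.space
      ; C∈K = PrefixSpan.space-finite
      ; ι = λ n → proj₁ (stage-step n)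
      ; j = PrefixSpan.inclusion
      ; j-compat = λ n → proj₂ (stage-step n)
      ; cover-X = λ x → let k , ek = enum-surjective points x in
                        suc k , PrefixSpan.located (suc k) (prefix-hit points k ek)
      ; cover-D = λ δ → let k , ek = enum-surjective distances δ
                            δ∈ = PrefixSpan.ds₀⊆ (suc k) (prefix-hit distances k ek)
                        in suc k , PrefixSpan.index-of (suc k) δ∈ , PrefixSpan.δ-at-index (suc k) δ∈
      }
    ; universal = rich-universal
    ; homogeneous = rich-homogeneous rich
    }

  module ImageSpan {B : Ult} (finB : IsFinUlt B) (e : B ⇒ W) where
    open ListSpan W _≟D_ (imagePoints finB e) (imageDistances finB e) public

    corestriction : Σ (B ⇒ space) λ h → (inclusion ∘e h) ≗e e
    corestriction = corestrict e (λ x → located (∈-imagePoints finB e x))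
                                 (λ δ → ds₀⊆ (∈-imageDistances finB e δ))

    h : B ⇒ space
    h = proj₁ corestriction

    h-commutes : ∀ x → point-at (f h x) ≡ f e x
    h-commutes = proj₁ (proj₂ corestriction)

    point-preimage : ∀ k → ∃[ x ] f h x ≡ k
    point-preimage k =
      let x , _ , eq = ∈-map⁻ (f e) (point-at∈ k)
      in x , point-at-injective (trans (h-commutes x) (sym eq))

    distance-preimage : ∀ k → ∃[ δ ] Df e δ ≡ δ-at k
    distance-preimage k with ∈-candidates⁻ (δ-at∈ k)
    ... | inj₁ eq = 0D B , trans (Df-0 e) (sym eq)
    ... | inj₂ (inj₁ δ∈) = let δ , _ , eq = ∈-map⁻ (Df e) δ∈ in δ , sym eq
    ... | inj₂ (inj₂ (a , b , eq)) =
      let x , hx = point-preimage a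
          x' , hx' = point-preimage b
      in d B x x' , (begin
        Df e (d B x x')                   ≡⟨ preserves e x x' ⟨
        d W (f e x) (f e x')              ≡⟨ cong₂ (d W) (h-commutes x) (h-commutes x') ⟨
        d W (point-at (f h x)) (point-at (f h x'))  ≡⟨ cong₂ (λ a b → d W (point-at a) (point-at b)) hx hx' ⟩
        d W (point-at a) (point-at b)     ≡⟨ eq ⟨
        δ-at k                            ∎)
      where open ≡-Reasoning

    isomorphism : B ≅ space
    isomorphism = h , point-preimage
                    , λ k → let δ , eq = distance-preimage k in
                            δ , δ-at-injective (trans (proj₂ (proj₂ corestriction) δ) eq)

  spanOf : Maybe (List (X W) × List (D W)) → Ult
  spanOf nothing = ListSpan.space W _≟D_ [] []
  spanOf (just (xs , ds)) = ListSpan.space W _≟D_ xs ds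

  spanOf-finite : ∀ m → IsFinUlt (spanOf m)
  spanOf-finite nothing = ListSpan.space-finite W _≟D_ [] []
  spanOf-finite (just (xs , ds)) = ListSpan.space-finite W _≟D_ xs ds

  finiteSubspaces : Enumeration (List (X W) × List (D W))
  finiteSubspaces = lists points ⊗ lists distances

  ≅-finiteSubspace : ∀ B → IsFinUlt B → ∃[ n ] B ≅ spanOf (enum finiteSubspaces n)
  ≅-finiteSubspace B finB =
    let n , eq = enum-surjective finiteSubspaces (imagePoints finB e , imageDistances finB e)
    in n , subst (λ m → B ≅ spanOf m) (sym eq) (ImageSpan.isomorphism finB e)
    where
    e : B ⇒ W
    e = rich-universal B finB

  module Joint {B C : Ult} (finB : IsFinUlt B) (finC : IsFinUlt C) (eB : B ⇒ W) (eC : C ⇒ W) where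
    open ListSpan W _≟D_ (imagePoints finB eB ++ imagePoints finC eC)
                         (imageDistances finB eB ++ imageDistances finC eC) public

    left : Σ (B ⇒ space) λ h → (inclusion ∘e h) ≗e eB
    left = corestrict eB (λ x → located (∈-++⁺ˡ (∈-imagePoints finB eB x)))
                         (λ δ → ds₀⊆ (∈-++⁺ˡ (∈-imageDistances finB eB δ)))

    right : Σ (C ⇒ space) λ h → (inclusion ∘e h) ≗e eC
    right = corestrict eC (λ x → located (∈-++⁺ʳ (imagePoints finB eB) (∈-imagePoints finC eC x)))
                          (λ δ → ds₀⊆ (∈-++⁺ʳ (imageDistances finB eB) (∈-imageDistances finC eC δ)))

  jointEmbedding : ∀ B C → IsFinUlt B → IsFinUlt C → Σ Ult λ E → (IsFinUlt E × (B ⇒ E) × (C ⇒ E))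
  jointEmbedding B C finB finC = J.space , J.space-finite , proj₁ J.left , proj₁ J.right
    where module J = Joint finB finC (rich-universal B finB) (rich-universal C finC)

  amalgamation : ∀ A B C → IsFinUlt A → IsFinUlt B → IsFinUlt C → (g : A ⇒ B) (h : A ⇒ C) →
                 Σ Ult λ E → (IsFinUlt E × Σ (B ⇒ E) λ g' → Σ (C ⇒ E) λ h' → (g' ∘e g) ≗e (h' ∘e h))
  amalgamation A B C finA finB finC g h =
    J.space , J.space-finite , proj₁ J.left , proj₁ J.right ,
    ∘e-cancelˡ J.inclusion {proj₁ J.left ∘e g} {proj₁ J.right ∘e h} commutes
    where
    eC : C ⇒ W
    eC = rich-universal C finC
    eB : Σ (B ⇒ W) λ eB → (eB ∘e g) ≗e (eC ∘e h)
    eB = extension-finiteExtension extension A B finA finB g (eC ∘e h)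
    module J = Joint finB finC (proj₁ eB) eC
    commutes : (J.inclusion ∘e (proj₁ J.left ∘e g)) ≗e (J.inclusion ∘e (proj₁ J.right ∘e h))
    commutes =
        (λ x → trans (proj₁ (proj₂ J.left) (f g x))
                     (trans (proj₁ (proj₂ eB) x) (sym (proj₁ (proj₂ J.right) (f h x)))))
      , (λ δ → trans (proj₂ (proj₂ J.left) (Df g δ))
                     (trans (proj₂ (proj₂ eB) δ) (sym (proj₂ (proj₂ J.right) (Df h δ)))))

  rich-fraisseClass : IsFraisseClass IsFinUlt
  rich-fraisseClass = record
    { nonempty = spanOf nothing , spanOf-finite nothing
    ; countablyManyTypes = (λ n → spanOf (enum finiteSubspaces n))
                         , (λ n → spanOf-finite (enum finiteSubspaces n))
                         , ≅-finiteSubspace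
    ; jep = jointEmbedding
    ; ap = amalgamation
    }

-- Fraïssé limits are rich

module _ {U : Ult} (limit : IsFraisseLimit IsFinUlt U) where
  open IsFraisseLimit limit
  open IsKChainUnion chain

  limit-finiteExtension : FiniteExtension U
  limit-finiteExtension F G finF finG i e =
    let (σ , _) , σ∘ui≗e = homogeneous F finF (universal G finG ∘e i) e
    in σ ∘e universal G finG , σ∘ui≗e

  liftD : ∀ k n → D (C n) → D (C (k + n))
  liftD zero n ε = ε
  liftD (suc k) n ε = Df (ι (k + n)) (liftD k n ε)

  j-liftD : ∀ k n ε → Df (j (k + n)) (liftD k n ε) ≡ Df (j n) ε
  j-liftD zero n ε = refl
  j-liftD (suc k) n ε = trans (proj₂ (j-compat (k + n)) (liftD k n ε)) (j-liftD k n ε)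

  common-stage : ∀ δ δ' →
                 ∃[ N ] Σ (D (C N)) λ ε → Σ (D (C N)) λ ε' → Df (j N) ε ≡ δ × Df (j N) ε' ≡ δ'
  common-stage δ δ' =
    let n , ε , jε≡δ = cover-D δ
        m , ε' , jε'≡δ' = cover-D δ'
        ε'′ , jε'′≡jε' = subst (λ N → Σ (D (C N)) λ β → Df (j N) β ≡ Df (j m) ε') (ℕ.+-comm n m)
                                (liftD n m ε' , j-liftD n m ε')
    in m + n , liftD m n ε , ε'′ , trans (j-liftD m n ε) jε≡δ , trans jε'′≡jε' jε'≡δ'

  limit-≟D : DecidableEquality (D U)
  limit-≟D δ δ' =
    let N , ε , ε' , jε≡δ , jε'≡δ' = common-stage δ δ'
    in map′ (λ ε≡ε' → trans (sym jε≡δ) (trans (cong (Df (j N)) ε≡ε') jε'≡δ'))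
            (λ δ≡δ' → Df-inj (j N) (trans jε≡δ (trans δ≡δ' (sym jε'≡δ'))))
            (finite-≟ (proj₂ (C∈K N)) ε ε')

  module LimitPoint (S : Ult) (_≟S_ : DecidableEquality (D S)) (φ : D S → D U)
                    (φ-emb : IsDistanceEmbedding S U φ) {n : ℕ} (p : Fin (suc n) → X S)
                    (p-injective : Injective p) (y : Fin n → X U)
                    (y-isometric : ∀ a b → d U (y a) (y b) ≡ φ (d S (p (suc a)) (p (suc b)))) where
    module G = Span S _≟S_ p p-injective []
    -- F is given every distance of G, so that the extension e′ is determined on all of D G.
    module F = Span S _≟S_ (λ a → p (suc a)) (λ eq → Fin.suc-injective (p-injective eq)) G.candidates

    F⊆G : Σ (F.space ⇒ G.space) λ ι → (G.inclusion ∘e ι) ≗e F.inclusion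
    F⊆G = G.corestrict F.inclusion (λ a → suc a , refl) distance∈
      where
      distance∈ : ∀ k → F.δ-at k ∈ G.candidates
      distance∈ k with F.∈-candidates⁻ (F.δ-at∈ k)
      ... | inj₁ eq = subst (_∈ G.candidates) (sym eq) G.0∈
      ... | inj₂ (inj₁ δ∈) = δ∈
      ... | inj₂ (inj₂ (a , b , eq)) = subst (_∈ G.candidates) (sym eq) (G.pair∈ (suc a) (suc b))

    F↪G : F.space ⇒ G.space
    F↪G = proj₁ F⊆G

    e : F.space ⇒ U
    e = isometry-embedding (∘-distanceEmbedding φ-emb (Df-distanceEmbedding F.inclusion)) y
          (λ a b → trans (y-isometric a b) (cong φ (sym (F.δ-at-distance a b))))

    extended : Σ (G.space ⇒ U) λ e' → (e' ∘e F↪G) ≗e e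
    extended = limit-finiteExtension F.space G.space F.space-finite G.space-finite F↪G e

    e' : G.space ⇒ U
    e' = proj₁ extended

    Df-e' : ∀ k → Df e' k ≡ φ (G.δ-at k)
    Df-e' k = begin
      Df e' k           ≡⟨ cong (Df e') ι-k'≡k ⟨
      Df e' (Df F↪G k')   ≡⟨ proj₂ (proj₂ extended) k' ⟩
      φ (F.δ-at k')     ≡⟨ cong φ (F.δ-at-index (F.ds₀⊆ (G.δ-at∈ k))) ⟩
      φ (G.δ-at k)      ∎
      where
      open ≡-Reasoning
      k' : Fin F.m
      k' = F.index-of (F.ds₀⊆ (G.δ-at∈ k))
      ι-k'≡k : Df F↪G k' ≡ k
      ι-k'≡k = G.δ-at-injective (trans (proj₂ (proj₂ F⊆G) k') (F.δ-at-index (F.ds₀⊆ (G.δ-at∈ k))))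

    realizes : ∀ a → d U (f e' zero) (y a) ≡ φ (d S (p zero) (p (suc a)))
    realizes a = begin
      d U (f e' zero) (y a)                ≡⟨ cong (d U _) (proj₁ (proj₂ extended) a) ⟨
      d U (f e' zero) (f e' (suc a))       ≡⟨ preserves e' zero (suc a) ⟩
      Df e' (G.distance zero (suc a))      ≡⟨ Df-e' _ ⟩
      φ (G.δ-at (G.distance zero (suc a))) ≡⟨ cong φ (G.δ-at-distance zero (suc a)) ⟩
      φ (d S (p zero) (p (suc a)))         ∎
      where open ≡-Reasoning

  limit-realizePoint : PointRealization U
  limit-realizePoint S _≟S_ φ φ-emb p p-injective y y-isometric =
    f (LimitPoint.e' S _≟S_ φ φ-emb p p-injective y y-isometric) zero ,
    LimitPoint.realizes S _≟S_ φ φ-emb p p-injective y y-isometric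

  module LimitDistance (S : Ult) (_≟S_ : DecidableEquality (D S)) (l : List (D S × D U))
                       (c : Coherent (OrderMatched S U) l) (0∈l : (0D S , 0D U) ∈ l)
                       (δ : D S) where
    no-points : Fin 0 → X S
    no-points ()

    no-points-injective : Injective no-points
    no-points-injective {()}

    module F = Span S _≟S_ no-points no-points-injective (map proj₁ l)
    module G = Span S _≟S_ no-points no-points-injective (δ ∷ map proj₁ l)

    F⊆G : Σ (F.space ⇒ G.space) λ ι → (G.inclusion ∘e ι) ≗e F.inclusion
    F⊆G = G.corestrict F.inclusion (λ ()) distance∈
      where
      distance∈ : ∀ k → F.δ-at k ∈ G.candidates
      distance∈ k with F.∈-candidates⁻ (F.δ-at∈ k)
      ... | inj₁ eq = subst (_∈ G.candidates) (sym eq) G.0∈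
      ... | inj₂ (inj₁ δ∈) = G.ds₀⊆ (there δ∈)
      ... | inj₂ (inj₂ (() , _))

    F↪G : F.space ⇒ G.space
    F↪G = proj₁ F⊆G

    paired : ∀ {δ'} → δ' ∈ F.candidates → Σ (D U) λ ε → (δ' , ε) ∈ l
    paired δ'∈ with F.∈-candidates⁻ δ'∈
    ... | inj₁ refl = 0D U , 0∈l
    ... | inj₂ (inj₁ δ'∈dom) = partner δ'∈dom
    ... | inj₂ (inj₂ (() , _))

    ε-at : Fin F.m → D U
    ε-at k = proj₁ (paired (F.δ-at∈ k))

    ε-at∈ : ∀ k → (F.δ-at k , ε-at k) ∈ l
    ε-at∈ k = proj₂ (paired (F.δ-at∈ k))

    paired-unique : ∀ {δ' ε ε'} → (δ' , ε) ∈ l → (δ' , ε') ∈ l → ε ≡ ε'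
    paired-unique p∈ q∈ = order-functional S U (c p∈ q∈) (c q∈ p∈)

    e : F.space ⇒ U
    e = isometry-embedding ε-embedding (λ ()) (λ ())
      where
      k₀ : Fin F.m
      k₀ = F.index-of F.0∈
      ε-embedding : IsDistanceEmbedding F.space U ε-at
      ε-embedding = record
        { mono = λ {k} {k'} → proj₁ (c (ε-at∈ k) (ε-at∈ k'))
        ; reflect = λ {k} {k'} → proj₂ (c (ε-at∈ k) (ε-at∈ k'))
        ; 0↦0 = paired-unique (subst (λ δ' → (δ' , ε-at k₀) ∈ l) (F.δ-at-index F.0∈) (ε-at∈ k₀)) 0∈l
        }

    extended : Σ (G.space ⇒ U) λ e' → (e' ∘e F↪G) ≗e e
    extended = limit-finiteExtension F.space G.space F.space-finite G.space-finite F↪G e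

    e' : G.space ⇒ U
    e' = proj₁ extended

    iδ : Fin G.m
    iδ = G.index-of (there (here refl))

    ε : D U
    ε = Df e' iδ

    matched-with : ∀ {δ' ε'} → (δ' , ε') ∈ l →
                   OrderMatched S U (δ , ε) (δ' , ε') × OrderMatched S U (δ' , ε') (δ , ε)
    matched-with {δ'} {ε'} δ'ε'∈ =
        subst₂ (OrderMatched S U) (cong (_, ε) at-iδ) (cong₂ _,_ at-k' e'-k') (Df-order e' iδ (Df F↪G k'))
      , subst₂ (OrderMatched S U) (cong₂ _,_ at-k' e'-k') (cong (_, ε) at-iδ) (Df-order e' (Df F↪G k') iδ)
      where
      at-iδ : G.δ-at iδ ≡ δ
      at-iδ = G.δ-at-index (there (here refl))
      δ'∈ : δ' ∈ F.candidates
      δ'∈ = F.ds₀⊆ (∈-map⁺ proj₁ δ'ε'∈)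
      k' : Fin F.m
      k' = F.index-of δ'∈
      at-k' : G.δ-at (Df F↪G k') ≡ δ'
      at-k' = trans (proj₂ (proj₂ F⊆G) k') (F.δ-at-index δ'∈)
      e'-k' : Df e' (Df F↪G k') ≡ ε'
      e'-k' = trans (proj₂ (proj₂ extended) k')
                    (paired-unique (subst (λ δ'' → (δ'' , ε-at k') ∈ l) (F.δ-at-index δ'∈) (ε-at∈ k'))
                                   δ'ε'∈)

    coherent : Coherent (OrderMatched S U) ((δ , ε) ∷ l)
    coherent = coherent-∷ c ((λ _ → Order.≤-refl U) , (λ _ → Order.≤-refl S)) matched-with

  limit-extendDistance : DistanceExtension U
  limit-extendDistance S _≟S_ l c 0∈l δ _ =
    LimitDistance.ε S _≟S_ l c 0∈l δ , LimitDistance.coherent S _≟S_ l c 0∈l δ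

  limit-rich : Rich U
  limit-rich = record
    { _≟D_ = limit-≟D
    ; points = ⋃-enumeration (λ n → finite-enumeration (proj₁ (C∈K n))) (λ n → f (j n)) cover-X
    ; distances = ⋃-enumeration (λ n → finite-enumeration (proj₂ (C∈K n))) (λ n → Df (j n)) cover-D
    ; extension = record { realize-point = limit-realizePoint ; extend-distance = limit-extendDistance }
    }

≡₊ : {p q : ℚ≥0} → proj₁ p ≡ proj₁ q → p ≡ q
≡₊ {p , 0≤p} {.p , 0≤p′} refl = cong (p ,_) (ℚ.≤-irrelevant 0≤p 0≤p′)

_≟₊_ : DecidableEquality ℚ≥0
p ≟₊ q = map′ ≡₊ (cong proj₁) (proj₁ p ℚ.≟ proj₁ q)

ℤ-enumeration : Enumeration ℤ
ℤ-enumeration = image ℕ²-enumeration signed surjective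
  where
  signed : ℕ × ℕ → ℤ
  signed (a , zero) = + a
  signed (a , suc _) = -[1+ a ]
  surjective : Surjective signed
  surjective (+ a) = (a , 0) , refl
  surjective -[1+ a ] = (a , 1) , refl

ℚ-enumeration : Enumeration ℚ
ℚ-enumeration = image (ℤ-enumeration ⊗ ℕ-enumeration) (λ (i , b) → i / suc b)
                  (λ q → (ℚ.numerator q , ℚ.denominator-1 q) , ℚ.↥p/↧p≡p q)

ℚ≥0-enumeration : Enumeration ℚ≥0
ℚ≥0-enumeration = partialImage ℚ-enumeration nonNegative (λ q → proj₁ q , nonNegative-≥0 q)
  where
  nonNegative : ℚ → Maybe ℚ≥0
  nonNegative q with 0ℚ ℚ.≤? q
  ... | yes 0≤q = just (q , 0≤q)
  ... | no _ = nothing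
  nonNegative-≥0 : ∀ q → nonNegative (proj₁ q) ≡ just q
  nonNegative-≥0 (q , 0≤q) with 0ℚ ℚ.≤? q
  ... | yes _ = cong just (≡₊ refl)
  ... | no 0≰q = ⊥-elim (0≰q 0≤q)

<-⊓ : ∀ {m h q} → m <ℚ h → m <ℚ q → m <ℚ h ⊓ q
<-⊓ {m} {h} {q} m<h m<q with ℚ.⊓-sel h q
... | inj₁ eq = subst (m <ℚ_) (sym eq) m<h
... | inj₂ eq = subst (m <ℚ_) (sym eq) m<q

⊔-< : ∀ {m a h} → m <ℚ h → a <ℚ h → m ⊔ a <ℚ h
⊔-< {m} {a} {h} m<h a<h with ℚ.⊔-sel m a
... | inj₁ eq = subst (_<ℚ h) (sym eq) m<h
... | inj₂ eq = subst (_<ℚ h) (sym eq) a<h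

≤∧≢⇒< : ∀ {a b} → a ≤ℚ b → a ≢ b → a <ℚ b
≤∧≢⇒< a≤b a≢b = ℚ.≰⇒> λ b≤a → a≢b (ℚ.≤-antisym a≤b b≤a)

≤⊔-right : ∀ {a b c} → a ≤ℚ b ⊔ c → b <ℚ a → a ≤ℚ c
≤⊔-right {a} {b} {c} a≤b⊔c b<a with ℚ.⊔-sel b c
... | inj₁ b⊔c≡b = ⊥-elim (ℚ.<-irrefl refl (ℚ.<-≤-trans b<a (subst (a ≤ℚ_) b⊔c≡b a≤b⊔c)))
... | inj₂ b⊔c≡c = subst (a ≤ℚ_) b⊔c≡c a≤b⊔c

ℚ-above : ∀ m (hs : List ℚ) → All (m <ℚ_) hs → ∃[ q ] m <ℚ q × All (q <ℚ_) hs
ℚ-above m [] [] = m +ℚ 1ℚ , m<m+1 , []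
  where
  m<m+1 : m <ℚ m +ℚ 1ℚ
  m<m+1 = subst (_<ℚ m +ℚ 1ℚ) (ℚ.+-identityʳ m) (ℚ.+-mono-≤-< (ℚ.≤-refl {m}) (ℚ.positive⁻¹ 1ℚ))
ℚ-above m (h ∷ hs) (m<h ∷ m<hs) =
  let q , m<q , q<hs = ℚ-above m hs m<hs
      r , m<r , r<h⊓q = ℚ.<-dense (<-⊓ m<h m<q)
  in r , m<r , ℚ.<-≤-trans r<h⊓q (ℚ.p⊓q≤p h q)
             ∷ All.map (ℚ.<-trans (ℚ.<-≤-trans r<h⊓q (ℚ.p⊓q≤q h q))) q<hs

ℚ-interpolate : ∀ m (ls hs : List ℚ) → All (m <ℚ_) hs → All (λ a → All (a <ℚ_) hs) ls →
                ∃[ q ] m <ℚ q × All (_<ℚ q) ls × All (q <ℚ_) hs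
ℚ-interpolate m [] hs m<hs [] = let q , m<q , q<hs = ℚ-above m hs m<hs in q , m<q , [] , q<hs
ℚ-interpolate m (a ∷ ls) hs m<hs (a<hs ∷ ls<hs) =
  let m⊔a<hs = All.zipWith (λ (m<h , a<h) → ⊔-< m<h a<h) (m<hs , a<hs)
      q , m⊔a<q , ls<q , q<hs = ℚ-interpolate (m ⊔ a) ls hs m⊔a<hs ls<hs
  in q , ℚ.≤-<-trans (ℚ.p≤p⊔q m a) m⊔a<q , ℚ.≤-<-trans (ℚ.p≤q⊔p m a) m⊔a<q ∷ ls<q , q<hs

module _ (V : RUlt) where

  module RationalDistance (S : Ult) (_≟S_ : DecidableEquality (D S)) (l : List (D S × ℚ≥0))
                          (c : Coherent (OrderMatched S (asUlt V)) l) (0∈l : (0D S , 0₊) ∈ l)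
                          (δ : D S) (δ∉ : δ ∉ map proj₁ l) where
    open NonStrictToStrict _≡_ (_≤_ S) using (_<_)
    open IsStrictTotalOrder (NonStrictToStrict.<-isStrictTotalOrder₁ _≡_ (_≤_ S) _≟S_ (isTotalOrder S))
      using (compare; _<?_) renaming (trans to <-trans; asym to <-asym)

    value : D S × ℚ≥0 → ℚ
    value p = proj₁ (proj₂ p)

    below above : List (D S × ℚ≥0)
    below = filter (λ p → proj₁ p <? δ) l
    above = filter (λ p → δ <? proj₁ p) l

    increasing : ∀ {p q} → p ∈ l → q ∈ l → proj₁ p < proj₁ q → value p <ℚ value q
    increasing p∈ q∈ (δ₁≤δ₂ , δ₁≢δ₂) =
      ℚ.≰⇒> (λ ε₂≤ε₁ → δ₁≢δ₂ (Order.≤-antisym S δ₁≤δ₂ (proj₂ (c q∈ p∈) ε₂≤ε₁)))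

    below<above : ∀ {a h} → a ∈ map value below → h ∈ map value above → a <ℚ h
    below<above a∈ h∈ with ∈-map⁻ value a∈ | ∈-map⁻ value h∈
    ... | p , p∈ , refl | q , q∈ , refl =
      let p∈l , p<δ = ∈-filter⁻ (λ p → proj₁ p <? δ) p∈
          q∈l , δ<q = ∈-filter⁻ (λ p → δ <? proj₁ p) q∈
      in increasing p∈l q∈l (<-trans p<δ δ<q)

    0<δ : 0D S < δ
    0<δ = 0-least S δ , λ 0≡δ → δ∉ (subst (_∈ map proj₁ l) 0≡δ (∈-map⁺ proj₁ 0∈l))

    0∈below : 0ℚ ∈ map value below
    0∈below = ∈-map⁺ value (∈-filter⁺ (λ p → proj₁ p <? δ) 0∈l 0<δ)

    separated : All (λ a → All (a <ℚ_) (map value above)) (map value below)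
    separated = All.tabulate λ a∈ → All.tabulate λ h∈ → below<above a∈ h∈

    interpolant : ∃[ q ] 0ℚ <ℚ q × All (_<ℚ q) (map value below) × All (q <ℚ_) (map value above)
    interpolant = ℚ-interpolate 0ℚ (map value below) (map value above) (All.lookup separated 0∈below) separated

    ε : ℚ≥0
    ε = proj₁ interpolant , ℚ.<⇒≤ (proj₁ (proj₂ interpolant))

    below-ε : ∀ {q} → q ∈ l → proj₁ q < δ → value q <ℚ proj₁ ε
    below-ε q∈ q<δ =
      All.lookup (proj₁ (proj₂ (proj₂ interpolant))) (∈-map⁺ value (∈-filter⁺ (λ p → proj₁ p <? δ) q∈ q<δ))

    ε-above : ∀ {q} → q ∈ l → δ < proj₁ q → proj₁ ε <ℚ value q
    ε-above q∈ δ<q =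
      All.lookup (proj₂ (proj₂ (proj₂ interpolant))) (∈-map⁺ value (∈-filter⁺ (λ p → δ <? proj₁ p) q∈ δ<q))

    matched-with : ∀ {q} → q ∈ l → OrderMatched S (asUlt V) (δ , ε) q × OrderMatched S (asUlt V) q (δ , ε)
    matched-with {δ' , ε'} q∈ with compare δ' δ
    ... | tri< δ'<δ _ _ =
      let ε'<ε = below-ε q∈ δ'<δ
      in ((λ δ≤δ' → ⊥-elim (proj₂ δ'<δ (Order.≤-antisym S (proj₁ δ'<δ) δ≤δ')))
         , (λ ε≤ε' → ⊥-elim (ℚ.<-irrefl refl (ℚ.<-≤-trans ε'<ε ε≤ε'))))
       , ((λ _ → ℚ.<⇒≤ ε'<ε) , (λ _ → proj₁ δ'<δ))
    ... | tri≈ _ δ'≡δ _ = ⊥-elim (δ∉ (subst (_∈ map proj₁ l) δ'≡δ (∈-map⁺ proj₁ q∈)))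
    ... | tri> _ _ δ<δ' =
      let ε<ε' = ε-above q∈ δ<δ'
      in ((λ _ → ℚ.<⇒≤ ε<ε') , (λ _ → proj₁ δ<δ'))
       , ((λ δ'≤δ → ⊥-elim (proj₂ δ<δ' (Order.≤-antisym S (proj₁ δ<δ') δ'≤δ)))
         , (λ ε'≤ε → ⊥-elim (ℚ.<-irrefl refl (ℚ.<-≤-trans ε<ε' ε'≤ε))))

    coherent : Coherent (OrderMatched S (asUlt V)) ((δ , ε) ∷ l)
    coherent = coherent-∷ c ((λ _ → ℚ.≤-refl) , (λ _ → Order.≤-refl S)) matched-with

  ℚ-extendDistance : DistanceExtension (asUlt V)
  ℚ-extendDistance S _≟S_ l c 0∈l δ δ∉ =
    RationalDistance.ε S _≟S_ l c 0∈l δ δ∉ , RationalDistance.coherent S _≟S_ l c 0∈l δ δ∉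

-- Rational Urysohn spaces are rich

isometry-⇒ᵢ : {A B : RUlt} (h : RX A → RX B) → (∀ x x' → rd B (h x) (h x') ≡ rd A x x') → A ⇒ᵢ B
isometry-⇒ᵢ {A} {B} h isometric = record
  { g = h
  ; g-inj = λ {x} {x'} eq → proj₁ (rd-zero A x x') (trans (sym (isometric x x')) (proj₂ (rd-zero B _ _) eq))
  ; g-iso = isometric
  }

module _ (V : RUlt) {S : Ult} {φ : D S → ℚ≥0} (φ-emb : IsDistanceEmbedding S (asUlt V) φ) where
  open IsDistanceEmbedding φ-emb

  rationalPullback : ∀ {k} (q : Fin k → X S) → Injective q → RUlt
  rationalPullback {k} q q-injective = record
    { RX = Fin k
    ; rd = λ a b → proj₁ (φ (d S (q a) (q b)))
    ; rd-nonneg = λ a b → proj₂ (φ (d S (q a) (q b)))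
    ; rd-sym = λ a b → cong (λ δ → proj₁ (φ δ)) (d-sym S _ _)
    ; rd-zero = λ a b →
        (λ eq → q-injective (proj₁ (d-zero S _ _) (reflects-0 (≡₊ {φ (d S (q a) (q b))} {0₊} eq))))
      , (λ eq → cong proj₁ (trans (cong φ (proj₂ (d-zero S _ _) (cong q eq))) 0↦0))
    ; rd-ultra = λ a b c → Sum.map mono mono (d-ultra S (q a) (q b) (q c))
    }

module _ {V : RUlt} (urysohn : IsRationalUrysohn V) where
  open IsRationalUrysohn urysohn

  urysohn-realizePoint : PointRealization (asUlt V)
  urysohn-realizePoint S _ φ φ-emb {n} p p-injective y y-isometric = g σ (g u zero) , realizes
    where
    G F : RUlt
    G = rationalPullback V φ-emb p p-injective
    F = rationalPullback V φ-emb (λ a → p (suc a)) (λ eq → Fin.suc-injective (p-injective eq))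
    u : G ⇒ᵢ V
    u = universal G (finite-Fin (suc n))
    u∘suc : F ⇒ᵢ V
    u∘suc = isometry-⇒ᵢ (λ a → g u (suc a)) (λ a b → g-iso u (suc a) (suc b))
    e : F ⇒ᵢ V
    e = isometry-⇒ᵢ y (λ a b → cong proj₁ (y-isometric a b))
    moved : Σ (V ⇒ᵢ V) λ σ → Surjective (g σ) × (∀ x → g σ (g u∘suc x) ≡ g e x)
    moved = homogeneous F (finite-Fin n) u∘suc e
    σ : V ⇒ᵢ V
    σ = proj₁ moved
    realizes : ∀ a → d (asUlt V) (g σ (g u zero)) (y a) ≡ φ (d S (p zero) (p (suc a)))
    realizes a = ≡₊ (begin
      rd V (g σ (g u zero)) (y a)                ≡⟨ cong (rd V _) (proj₂ (proj₂ moved) a) ⟨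
      rd V (g σ (g u zero)) (g σ (g u (suc a)))  ≡⟨ g-iso σ _ _ ⟩
      rd V (g u zero) (g u (suc a))              ≡⟨ g-iso u zero (suc a) ⟩
      proj₁ (φ (d S (p zero) (p (suc a))))       ∎)
      where open ≡-Reasoning

  urysohn-rich : Rich (asUlt V)
  urysohn-rich = record
    { _≟D_ = _≟₊_
    ; points = ⋃-enumeration (λ n → finite-enumeration (C-fin n)) (λ n → g (j n)) cover
    ; distances = ℚ≥0-enumeration
    ; extension = record { realize-point = urysohn-realizePoint ; extend-distance = ℚ-extendDistance V }
    }

-- A rich space of finitely supported functions

Entry : Set
Entry = ℚ × ℕ

-- A finitely supported function ℚ>0 → ℕ is listed by its support in decreasing order, an entry (q , k)
-- standing for the value suc k at q.
data Canonical : List Entry → Set where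
  [] : Canonical []
  cons : ∀ {q k l} → 0ℚ <ℚ q → All (λ e → proj₁ e <ℚ q) l → Canonical l → Canonical ((q , k) ∷ l)

value : List Entry → ℚ → ℕ
value [] s = 0
value ((q , k) ∷ l) s with s ℚ.≟ q
... | yes _ = suc k
... | no _ = value l s

value-hit : ∀ q k l → value ((q , k) ∷ l) q ≡ suc k
value-hit q k l with q ℚ.≟ q
... | yes _ = refl
... | no q≢q = ⊥-elim (q≢q refl)

value-miss : ∀ {q k l s} → s ≢ q → value ((q , k) ∷ l) s ≡ value l s
value-miss {q} {s = s} s≢q with s ℚ.≟ q
... | yes s≡q = ⊥-elim (s≢q s≡q)
... | no _ = refl

value-above : ∀ {t s} l → All (λ e → proj₁ e <ℚ t) l → t ≤ℚ s → value l s ≡ 0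
value-above [] [] _ = refl
value-above (_ ∷ l) (q<t ∷ l<t) t≤s =
  trans (value-miss (λ s≡q → ℚ.<⇒≢ (ℚ.<-≤-trans q<t t≤s) (sym s≡q))) (value-above l l<t t≤s)

value-beyond : ∀ {q k l s} → Canonical ((q , k) ∷ l) → q <ℚ s → value ((q , k) ∷ l) s ≡ 0
value-beyond {l = l} (cons _ l<q _) q<s =
  trans (value-miss (λ s≡q → ℚ.<⇒≢ q<s (sym s≡q))) (value-above l l<q (ℚ.<⇒≤ q<s))

-- the largest argument at which the two represented functions differ
dist : List Entry → List Entry → ℚ
dist [] [] = 0ℚ
dist [] ((q , _) ∷ _) = q
dist ((q , _) ∷ _) [] = q
dist ((q , k) ∷ l) ((q' , k') ∷ l') with q ℚ.≟ q'
... | no _ = q ⊔ q'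
... | yes _ with k ℕ.≟ k'
...   | yes _ = dist l l'
...   | no _ = q

dist-tails : ∀ {q k l l'} → dist ((q , k) ∷ l) ((q , k) ∷ l') ≡ dist l l'
dist-tails {q} {k} with q ℚ.≟ q
... | no q≢q = ⊥-elim (q≢q refl)
... | yes _ with k ℕ.≟ k
...   | yes _ = refl
...   | no k≢k = ⊥-elim (k≢k refl)

agree-above : ∀ {x z} → Canonical x → Canonical z → ∀ s → dist x z <ℚ s → value x s ≡ value z s
agree-above [] [] s _ = refl
agree-above [] cz@(cons _ _ _) s q<s = sym (value-beyond cz q<s)
agree-above cx@(cons _ _ _) [] s q<s = value-beyond cx q<s
agree-above {(q , k) ∷ _} {(q' , k') ∷ _} cx@(cons _ _ cl) cz@(cons _ _ cl') s d<s with q ℚ.≟ q'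
... | no _ = trans (value-beyond cx (ℚ.≤-<-trans (ℚ.p≤p⊔q q q') d<s))
                   (sym (value-beyond cz (ℚ.≤-<-trans (ℚ.p≤q⊔p q q') d<s)))
... | yes refl with k ℕ.≟ k'
...   | no _ = trans (value-beyond cx d<s) (sym (value-beyond cz d<s))
...   | yes refl with s ℚ.≟ q
...     | yes _ = refl
...     | no _ = agree-above cl cl' s d<s

differ-at : ∀ {x z} → Canonical x → Canonical z → dist x z ≢ 0ℚ → value x (dist x z) ≢ value z (dist x z)
differ-at [] [] d≢0 _ = d≢0 refl
differ-at [] (cons {q} {k} {l} _ _ _) _ eq = ℕ.0≢1+n (trans eq (value-hit q k l))
differ-at (cons {q} {k} {l} _ _ _) [] _ eq = ℕ.0≢1+n (trans (sym eq) (value-hit q k l))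
differ-at {(q , k) ∷ l} {(q' , k') ∷ l'} cx@(cons _ _ cl) cz@(cons _ _ cl') d≢0 eq with q ℚ.≟ q'
... | no q≢q' with ℚ.⊔-sel q q'
...   | inj₁ ⊔≡q =
  let q'<q = ≤∧≢⇒< (ℚ.p⊔q≡p⇒q≤p ⊔≡q) (λ q'≡q → q≢q' (sym q'≡q))
  in ℕ.1+n≢0 (trans (sym (value-hit q k l))
                    (trans (subst (λ t → value ((q , k) ∷ l) t ≡ value ((q' , k') ∷ l') t) ⊔≡q eq)
                           (value-beyond cz q'<q)))
...   | inj₂ ⊔≡q' =
  let q<q' = ≤∧≢⇒< (ℚ.p⊔q≡q⇒p≤q ⊔≡q') q≢q'
  in ℕ.0≢1+n (trans (sym (value-beyond cx q<q'))
                    (trans (subst (λ t → value ((q , k) ∷ l) t ≡ value ((q' , k') ∷ l') t) ⊔≡q' eq)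
                           (value-hit q' k' l')))
differ-at {(q , k) ∷ l} {(.q , k') ∷ l'} (cons _ l<q cl) (cons _ l'<q cl') d≢0 eq | yes refl with k ℕ.≟ k'
... | no k≢k' = k≢k' (ℕ.suc-injective (trans (sym (value-hit q k l)) (trans eq (value-hit q k' l'))))
... | yes refl with dist l l' ℚ.≟ q
...   | yes d≡q = differ-at cl cl' d≢0
                    (trans (value-above l l<q (ℚ.≤-reflexive (sym d≡q)))
                           (sym (value-above l' l'<q (ℚ.≤-reflexive (sym d≡q)))))
...   | no _ = differ-at cl cl' d≢0 eq

dist-nonneg : ∀ {x z} → Canonical x → Canonical z → 0ℚ ≤ℚ dist x z
dist-nonneg [] [] = ℚ.≤-refl
dist-nonneg [] (cons 0<q _ _) = ℚ.<⇒≤ 0<q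
dist-nonneg (cons 0<q _ _) [] = ℚ.<⇒≤ 0<q
dist-nonneg {(q , k) ∷ _} {(q' , k') ∷ _} (cons 0<q _ cl) (cons _ _ cl') with q ℚ.≟ q'
... | no _ = ℚ.≤-trans (ℚ.<⇒≤ 0<q) (ℚ.p≤p⊔q q q')
... | yes refl with k ℕ.≟ k'
...   | yes refl = dist-nonneg cl cl'
...   | no _ = ℚ.<⇒≤ 0<q

dist-self : ∀ x → dist x x ≡ 0ℚ
dist-self [] = refl
dist-self ((q , k) ∷ l) = trans (dist-tails {q} {k} {l} {l}) (dist-self l)

dist-zero : ∀ {x z} → Canonical x → Canonical z → dist x z ≡ 0ℚ → x ≡ z
dist-zero [] [] _ = refl
dist-zero [] (cons 0<q _ _) q≡0 = ⊥-elim (ℚ.<⇒≢ 0<q (sym q≡0))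
dist-zero (cons 0<q _ _) [] q≡0 = ⊥-elim (ℚ.<⇒≢ 0<q (sym q≡0))
dist-zero {(q , k) ∷ _} {(q' , k') ∷ _} (cons 0<q _ cl) (cons _ _ cl') d≡0 with q ℚ.≟ q'
... | no _ = ⊥-elim (ℚ.<-irrefl refl (ℚ.<-≤-trans 0<q (subst (q ≤ℚ_) d≡0 (ℚ.p≤p⊔q q q'))))
... | yes refl with k ℕ.≟ k'
...   | yes refl = cong ((q , k) ∷_) (dist-zero cl cl' d≡0)
...   | no _ = ⊥-elim (ℚ.<⇒≢ 0<q (sym d≡0))

dist-sym : ∀ x z → dist x z ≡ dist z x
dist-sym [] [] = refl
dist-sym [] (_ ∷ _) = refl
dist-sym (_ ∷ _) [] = refl
dist-sym ((q , k) ∷ l) ((q' , k') ∷ l') with q ℚ.≟ q' | q' ℚ.≟ q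
... | no _ | no _ = ℚ.⊔-comm q q'
... | yes refl | no q≢q = ⊥-elim (q≢q refl)
... | no q≢q | yes refl = ⊥-elim (q≢q refl)
... | yes refl | yes _ with k ℕ.≟ k' | k' ℕ.≟ k
...   | yes refl | yes _ = dist-sym l l'
...   | no _ | no _ = refl
...   | yes refl | no k≢k = ⊥-elim (k≢k refl)
...   | no k≢k | yes refl = ⊥-elim (k≢k refl)

dist-characterization : ∀ {x z} → Canonical x → Canonical z → ∀ s → value x s ≢ value z s →
                        (∀ t → s <ℚ t → value x t ≡ value z t) → dist x z ≡ s
dist-characterization {x} {z} cx cz s differ agree with ℚ.<-cmp (dist x z) s
... | tri< d<s _ _ = ⊥-elim (differ (agree-above cx cz s d<s))
... | tri≈ _ d≡s _ = d≡s
... | tri> _ _ s<d = ⊥-elim (differ-at cx cz d≢0 (agree _ s<d))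
  where
  d≢0 : dist x z ≢ 0ℚ
  d≢0 d≡0 with dist-zero cx cz d≡0
  ... | refl = differ refl

dist-ultra : ∀ {x y z} → Canonical x → Canonical y → Canonical z →
             dist x z ≤ℚ dist x y ⊎ dist x z ≤ℚ dist y z
dist-ultra {x} {y} {z} cx cy cz with dist x z ℚ.≤? dist x y | dist x z ℚ.≤? dist y z
... | yes le | _ = inj₁ le
... | no _ | yes le = inj₂ le
... | no xy<xz | no yz<xz =
  ⊥-elim (differ-at cx cz d≢0
    (trans (agree-above cx cy _ (ℚ.≰⇒> xy<xz)) (agree-above cy cz _ (ℚ.≰⇒> yz<xz))))
  where
  d≢0 : dist x z ≢ 0ℚ
  d≢0 d≡0 = ℚ.<-irrefl refl (ℚ.≤-<-trans (dist-nonneg cx cy) (subst (dist x y <ℚ_) d≡0 (ℚ.≰⇒> xy<xz)))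

canonical-irrelevant : ∀ {l} (c c' : Canonical l) → c ≡ c'
canonical-irrelevant [] [] = refl
canonical-irrelevant (cons 0<q l<q c) (cons 0<q' l<q' c')
  with ℚ.<-irrelevant 0<q 0<q' | All.irrelevant ℚ.<-irrelevant l<q l<q' | canonical-irrelevant c c'
... | refl | refl | refl = refl

canonical? : ∀ l → Dec (Canonical l)
canonical? [] = yes []
canonical? ((q , k) ∷ l) =
  map′ (λ (0<q , l<q , c) → cons 0<q l<q c) (λ { (cons 0<q l<q c) → 0<q , l<q , c })
       (0ℚ ℚ.<? q ×-dec All.all? (λ e → proj₁ e ℚ.<? q) l ×-dec canonical? l)

FinSupp : Set
FinSupp = Σ (List Entry) Canonical

FinSupp-≡ : {x y : FinSupp} → proj₁ x ≡ proj₁ y → x ≡ y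
FinSupp-≡ {l , c} {.l , c'} refl = cong (l ,_) (canonical-irrelevant c c')

finSupp : RUlt
finSupp = record
  { RX = FinSupp
  ; rd = λ x y → dist (proj₁ x) (proj₁ y)
  ; rd-nonneg = λ x y → dist-nonneg (proj₂ x) (proj₂ y)
  ; rd-sym = λ x y → dist-sym (proj₁ x) (proj₁ y)
  ; rd-zero = λ x y → (λ d≡0 → FinSupp-≡ (dist-zero (proj₂ x) (proj₂ y) d≡0))
                    , (λ { refl → dist-self (proj₁ x) })
  ; rd-ultra = λ x y z → dist-ultra (proj₂ x) (proj₂ y) (proj₂ z)
  }

FinSupp-enumeration : Enumeration FinSupp
FinSupp-enumeration = partialImage (lists (ℚ-enumeration ⊗ ℕ-enumeration)) canonicalise
                        (λ x → proj₁ x , canonicalise-canonical x)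
  where
  canonicalise : List Entry → Maybe FinSupp
  canonicalise l with canonical? l
  ... | yes c = just (l , c)
  ... | no _ = nothing
  canonicalise-canonical : ∀ x → canonicalise (proj₁ x) ≡ just x
  canonicalise-canonical (l , c) with canonical? l
  ... | yes _ = cong just (FinSupp-≡ refl)
  ... | no ¬c = ⊥-elim (¬c c)

cut : ℚ → ℕ → List Entry → List Entry
cut r M [] = (r , M) ∷ []
cut r M ((q , k) ∷ l) with r ℚ.<? q
... | yes _ = (q , k) ∷ cut r M l
... | no _ = (r , M) ∷ []

cut-all : ∀ {P : Entry → Set} {r M} l → All P l → P (r , M) → All P (cut r M l)
cut-all [] [] P-rM = P-rM ∷ []
cut-all {r = r} ((q , k) ∷ l) (P-qk ∷ P-l) P-rM with r ℚ.<? q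
... | yes _ = P-qk ∷ cut-all l P-l P-rM
... | no _ = P-rM ∷ []

cut-canonical : ∀ {r M l} → 0ℚ <ℚ r → Canonical l → Canonical (cut r M l)
cut-canonical 0<r [] = cons 0<r [] []
cut-canonical {r} 0<r (cons {q} 0<q l<q c) with r ℚ.<? q
... | yes r<q = cons 0<q (cut-all _ l<q r<q) (cut-canonical 0<r c)
... | no _ = cons 0<r [] []

value-cut-at : ∀ r M l → value (cut r M l) r ≡ suc M
value-cut-at r M [] = value-hit r M []
value-cut-at r M ((q , k) ∷ l) with r ℚ.<? q
... | yes r<q = trans (value-miss (ℚ.<⇒≢ r<q)) (value-cut-at r M l)
... | no _ = value-hit r M []

value-cut-above : ∀ {r M s l} → Canonical l → r <ℚ s → value (cut r M l) s ≡ value l s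
value-cut-above [] r<s = value-miss (λ s≡r → ℚ.<⇒≢ r<s (sym s≡r))
value-cut-above {r} {M} {s} cl@(cons {q} {k} {l} _ _ c) r<s with r ℚ.<? q
... | yes _ = cut-tail
  where
  cut-tail : value ((q , k) ∷ cut r M l) s ≡ value ((q , k) ∷ l) s
  cut-tail with s ℚ.≟ q
  ... | yes _ = refl
  ... | no _ = value-cut-above c r<s
... | no r≮q = trans (value-miss (λ s≡r → ℚ.<⇒≢ r<s (sym s≡r)))
                     (sym (value-beyond cl (ℚ.≤-<-trans (ℚ.≮⇒≥ r≮q) r<s)))

argmin : ∀ {m} (g : Fin (suc m) → ℚ) → Σ (Fin (suc m)) λ a₀ → ∀ a → g a₀ ≤ℚ g a
argmin {zero} g = zero , λ { zero → ℚ.≤-refl }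
argmin {suc m} g with argmin (λ a → g (suc a))
... | a₁ , a₁-min with g zero ℚ.≤? g (suc a₁)
...   | yes g0≤ = zero , λ { zero → ℚ.≤-refl ; (suc a) → ℚ.≤-trans g0≤ (a₁-min a) }
...   | no g0≰ = suc a₁ , λ { zero → ℚ.<⇒≤ (ℚ.≰⇒> g0≰) ; (suc a) → a₁-min a }

upperBound : ∀ {n} (g : Fin n → ℕ) → Σ ℕ λ M → ∀ a → g a ℕ.≤ M
upperBound {zero} g = 0 , λ ()
upperBound {suc n} g =
  let M , bounded = upperBound (λ a → g (suc a))
  in g zero ℕ.+ M , λ { zero → ℕ.m≤m+n (g zero) M ; (suc a) → ℕ.≤-trans (bounded a) (ℕ.m≤n+m M (g zero)) }

-- The new point agrees above r with the old point y a₀ nearest to it, at distance r, and takes at r a value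
-- different from all old points; the ultrametric inequality in S then forces all remaining distances.
module FinSuppPoint (S : Ult) (φ : D S → ℚ≥0) (φ-emb : IsDistanceEmbedding S (asUlt finSupp) φ)
                    {m : ℕ} (p : Fin (suc (suc m)) → X S) (p-injective : Injective p)
                    (y : Fin (suc m) → FinSupp)
                    (y-isometric : ∀ a b → d (asUlt finSupp) (y a) (y b) ≡ φ (d S (p (suc a)) (p (suc b)))) where
  open IsDistanceEmbedding φ-emb

  ρ : X S → X S → ℚ
  ρ x x' = proj₁ (φ (d S x x'))

  ρ-ultra : ∀ x x' x'' → ρ x x'' ≤ℚ ρ x x' ⊔ ρ x' x''
  ρ-ultra x x' x'' with d-ultra S x x' x''
  ... | inj₁ le = ℚ.≤-trans (mono le) (ℚ.p≤p⊔q (ρ x x') (ρ x' x''))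
  ... | inj₂ le = ℚ.≤-trans (mono le) (ℚ.p≤q⊔p (ρ x x') (ρ x' x''))

  ρ-sym : ∀ x x' → ρ x x' ≡ ρ x' x
  ρ-sym x x' = cong (λ δ → proj₁ (φ δ)) (d-sym S x x')

  L : Fin (suc m) → List Entry
  L a = proj₁ (y a)

  L-canonical : ∀ a → Canonical (L a)
  L-canonical a = proj₂ (y a)

  r-at : Fin (suc m) → ℚ
  r-at a = ρ (p zero) (p (suc a))

  a₀ : Fin (suc m)
  a₀ = proj₁ (argmin r-at)

  r : ℚ
  r = r-at a₀

  r-min : ∀ a → r ≤ℚ r-at a
  r-min = proj₂ (argmin r-at)

  0<r : 0ℚ <ℚ r
  0<r = ≤∧≢⇒< (proj₂ (φ (d S (p zero) (p (suc a₀))))) λ 0≡r →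
          Fin.0≢1+n (p-injective (proj₁ (d-zero S _ _)
            (reflects-0 (≡₊ {φ (d S (p zero) (p (suc a₀)))} {0₊} (sym 0≡r)))))

  M : ℕ
  M = proj₁ (upperBound (λ a → value (L a) r))

  M-bound : ∀ a → value (L a) r ℕ.≤ M
  M-bound = proj₂ (upperBound (λ a → value (L a) r))

  L₀ : List Entry
  L₀ = cut r M (L a₀)

  L₀-canonical : Canonical L₀
  L₀-canonical = cut-canonical 0<r (L-canonical a₀)

  s-at : Fin (suc m) → ℚ
  s-at a = dist (L a₀) (L a)

  s-at≡ρ : ∀ a → s-at a ≡ ρ (p (suc a₀)) (p (suc a))
  s-at≡ρ a = cong proj₁ (y-isometric a₀ a)

  r-at≤r⊔s : ∀ a → r-at a ≤ℚ r ⊔ s-at a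
  r-at≤r⊔s a = subst (λ s → r-at a ≤ℚ r ⊔ s) (sym (s-at≡ρ a)) (ρ-ultra (p zero) (p (suc a₀)) (p (suc a)))

  distance-above : ∀ a → r <ℚ s-at a → dist L₀ (L a) ≡ r-at a
  distance-above a r<s = trans dist≡s (ℚ.≤-antisym s≤r-at r-at≤s)
    where
    dist≡s : dist L₀ (L a) ≡ s-at a
    dist≡s = dist-characterization L₀-canonical (L-canonical a) (s-at a)
      (λ eq → differ-at (L-canonical a₀) (L-canonical a) (λ s≡0 → ℚ.<⇒≢ (ℚ.<-trans 0<r r<s) (sym s≡0))
                (trans (sym (value-cut-above (L-canonical a₀) r<s)) eq))
      (λ t s<t → trans (value-cut-above (L-canonical a₀) (ℚ.<-trans r<s s<t))
                       (agree-above (L-canonical a₀) (L-canonical a) t s<t))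
    s≤r-at : s-at a ≤ℚ r-at a
    s≤r-at = ≤⊔-right (subst₂ (λ s ρ₀ → s ≤ℚ ρ₀ ⊔ r-at a) (sym (s-at≡ρ a)) (ρ-sym (p (suc a₀)) (p zero))
                                (ρ-ultra (p (suc a₀)) (p zero) (p (suc a))))
                       r<s
    r-at≤s : r-at a ≤ℚ s-at a
    r-at≤s = subst (r-at a ≤ℚ_) (ℚ.p≤q⇒p⊔q≡q (ℚ.<⇒≤ r<s)) (r-at≤r⊔s a)

  distance-below : ∀ a → s-at a ≤ℚ r → dist L₀ (L a) ≡ r-at a
  distance-below a s≤r = trans dist≡r (ℚ.≤-antisym (r-min a) r-at≤r)
    where
    dist≡r : dist L₀ (L a) ≡ r
    dist≡r = dist-characterization L₀-canonical (L-canonical a) r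
      (λ eq → ℕ.<-irrefl refl (ℕ.≤-trans (ℕ.s≤s (M-bound a))
                                          (ℕ.≤-reflexive (trans (sym (value-cut-at r M (L a₀))) eq))))
      (λ t r<t → trans (value-cut-above (L-canonical a₀) r<t)
                       (agree-above (L-canonical a₀) (L-canonical a) t (ℚ.≤-<-trans s≤r r<t)))
    r-at≤r : r-at a ≤ℚ r
    r-at≤r = subst (r-at a ≤ℚ_) (ℚ.p≥q⇒p⊔q≡p s≤r) (r-at≤r⊔s a)

  y₀ : FinSupp
  y₀ = L₀ , L₀-canonical

  realizes : ∀ a → d (asUlt finSupp) y₀ (y a) ≡ φ (d S (p zero) (p (suc a)))
  realizes a with r ℚ.<? s-at a
  ... | yes r<s = ≡₊ (distance-above a r<s)
  ... | no r≮s = ≡₊ (distance-below a (ℚ.≮⇒≥ r≮s))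

finSupp-realizePoint : PointRealization (asUlt finSupp)
finSupp-realizePoint S _ φ φ-emb {zero} p p-injective y y-isometric = ([] , []) , λ ()
finSupp-realizePoint S _ φ φ-emb {suc m} p p-injective y y-isometric =
  y₀ , realizes
  where open FinSuppPoint S φ φ-emb p p-injective y y-isometric

finSupp-rich : Rich (asUlt finSupp)
finSupp-rich = record
  { _≟D_ = _≟₊_
  ; points = FinSupp-enumeration
  ; distances = ℚ≥0-enumeration
  ; extension = record { realize-point = finSupp-realizePoint ; extend-distance = ℚ-extendDistance finSupp }
  }

theorem3p11 : IsFraisseClass IsFinUlt
    × (Σ Ult λ U → IsFraisseLimit IsFinUlt U)
    × (∀ (U : Ult) → IsFraisseLimit IsFinUlt U →
         (∀ (V : RUlt) → IsRationalUrysohn V → U ≅ asUlt V)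
         × DcHomogeneous U × IsoHomogeneous U)
theorem3p11 =
    rich-fraisseClass finSupp-rich
  , (asUlt finSupp , rich-fraisseLimit finSupp-rich)
  , λ U limit → (λ V urysohn → rich-≅ (limit-rich limit) (urysohn-rich urysohn))
              , IsFraisseLimit.homogeneous limit
              , rich-isoHomogeneous (limit-rich limit)
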